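{- For every $P\in\mathbb{K}\langle X_i\mid i\in\mathbb{N}\rangle_+$, $$\delta_{\mathbf{NMI}}(P)=\sum_{k=1}^\infty\sum_{(j_1,\dots,j_k)\in\mathbb{N}^k}X_{j_1}\cdots X_{j_k}\otimes\Big(|^{(k-1)}\circ(D'^{j_1}\otimes\cdots\otimes D'^{j_k})\circ\tilde\Delta_{\mathrm{dec}}^{(k-1)}(P)\Big).$$ Its counit is the unique algebra morphism $\epsilon_{\delta_{\mathbf{NMI}}}:(T(\mathbb{K}\langle X_i\mid i\in\mathbb{N}\rangle_+),|)\to\mathbb{K}$ such that $\epsilon_{\delta_{\mathbf{NMI}}}(P)=\delta_{P,X_0}$ for every word $P$; equivalently $\epsilon_{\delta_{\mathbf{NMI}}}(P)=\frac{\partial P}{\partial X_0}(0,0,\dots)$ for $P\in\mathbb{K}\langle X_i\rangle_+$. Moreover $\delta_{\mathbf{NMI}}$ is homogeneous of degree $0$ for the weight and for the degree.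
   Context: $\mathbb{K}$ is a field of characteristic $0$; $(X_i)_{i\in\mathbb{N}}$ are non-commuting indeterminates and $\mathbf{NMI}(n)$ is the span of the words of length $n$. With $D$ the derivation of $\mathbb{K}\langle X_i\rangle_+$ such that $D(X_i)=X_{i+1}$, $\mathbf{NMI}$ is an operad with composition $X_{i_1}\cdots X_{i_n}\circ(P_1,\dots,P_n)=D^{i_1}(P_1)\cdots D^{i_n}(P_n)$ and unit $X_0$. $D'$ is the derivation of $\mathbb{K}\langle X_i\rangle_+$ with $D'(X_0)=0$ and $D'(X_i)=X_{i-1}$ for $i\geq1$. The words form an orthonormal basis for the pairing $\langle\cdot,\cdot\rangle$ on $\mathbb{K}\langle X_i\rangle_+$. $T(\mathbb{K}\langle X_i\rangle_+)$ is the tensor algebra, whose concatenation product is denoted $|$ (so $X_iX_j\neq X_i|X_j$); $|^{(k-1)}$ is the iterated product $A_1\otimes\cdots\otimes A_k\mapsto A_1|\cdots|A_k$; the pairing extends by $\langle P_1|\cdots|P_k,Q_1|\cdots|Q_l\rangle=\delta_{k,l}\prod_i\langle P_i,Q_i\rangle$. $\tilde\Delta_{\mathrm{dec}}(X_{i_1}\cdots X_{i_n})=\sum_{k=1}^{n-1}X_{i_1}\cdots X_{i_k}\otimes X_{i_{k+1}}\cdots X_{i_n}$ is the reduced deconcatenation coproduct and $\tilde\Delta_{\mathrm{dec}}^{(k-1)}$ its $(k-1)$-th iterate ($\tilde\Delta^{(0)}=\mathrm{Id}$). The coproduct $\delta_{\mathbf{NMI}}$ on $T(\mathbb{K}\langle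 X_i\rangle_+)$ is the $|$-multiplicative map dual to the operadic composition: for $P\in\mathbb{K}\langle X_i\rangle_+$, $\delta_{\mathbf{NMI}}(P)\in\mathbb{K}\langle X_i\rangle_+\otimes T(\mathbb{K}\langle X_i\rangle_+)$ is characterized by $\langle\delta_{\mathbf{NMI}}(P),Q\otimes Q_1|\cdots|Q_k\rangle=\langle P,Q\circ(Q_1,\dots,Q_k)\rangle$ for all $Q\in\mathbf{NMI}(k)$, $Q_1,\dots,Q_k\in\mathbb{K}\langle X_i\rangle_+$, $k\geq1$. The weight of a word is $i_1+\cdots+i_n$ and its degree is $i_1+\cdots+i_n-n+1$; both are extended additively to $|$-products and tensor products. -}

module Defs where

open import Level using (Level; _⊔_)
open import Algebra.Bundles using (CommutativeRing)
open import Data.Nat as ℕ using (ℕ; zero; suc; _≤_)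
open import Data.Integer as ℤ using (ℤ)
open import Data.List using (List; []; _∷_; _++_; map; concatMap; length; upTo; zipWith)
open import Data.Nat.ListAction using (sum)
open import Data.List.Relation.Unary.All using (All)
import Data.List.Properties as LP
import Data.Product.Properties as PP
open import Data.Product using (_×_; _,_; Σ; ∃)
open import Relation.Nullary using (¬_; yes; no)
open import Relation.Binary.PropositionalEquality using (_≡_; _≢_)
open import Relation.Binary.Definitions using (DecidableEquality)

natCast : ∀ {c ℓ} (R : CommutativeRing c ℓ) → ℕ → CommutativeRing.Carrier R
natCast R zero    = CommutativeRing.0# R
natCast R (suc n) = CommutativeRing._+_ R (CommutativeRing.1# R) (natCast R n)

record CharZeroField (c ℓ : Level) : Set (Level.suc (c ⊔ ℓ)) where
  field
    commutativeRing : CommutativeRing c ℓ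
  open CommutativeRing commutativeRing
  field
    0≉1       : ¬ (0# ≈ 1#)
    inverse   : ∀ x → ¬ (x ≈ 0#) → Σ Carrier λ y → (x * y) ≈ 1#
    charZero  : ∀ n → natCast commutativeRing n ≈ 0# → n ≡ 0
  open CommutativeRing commutativeRing public

-- Words: a word X_{i1}...X_{in} is the list [i1,...,in] of indices.
-- K<X_i>_+ is spanned by the NONEMPTY words.

Word : Set
Word = List ℕ

Nonempty : Word → Set
Nonempty w = 1 ≤ length w

-- basis of T(K<X_i>_+): lists of words  w1 | ... | wk  ([] is the unit)
TB : Set
TB = List Word

_≟W_ : DecidableEquality Word
_≟W_ = LP.≡-dec ℕ._≟_

_≟TB_ : DecidableEquality TB
_≟TB_ = LP.≡-dec _≟W_

_≟WT_ : DecidableEquality (Word × TB)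
_≟WT_ = PP.≡-dec _≟W_ _≟TB_

_≟TT_ : DecidableEquality (TB × TB)
_≟TT_ = PP.≡-dec _≟TB_ _≟TB_

weight : Word → ℕ
weight w = sum w

weightTB : TB → ℕ
weightTB t = sum (map weight t)

degree : Word → ℤ
degree w = (ℤ.+ weight w ℤ.- ℤ.+ length w) ℤ.+ ℤ.+ 1

degreeTB : TB → ℤ
degreeTB []      = ℤ.+ 0
degreeTB (w ∷ t) = degree w ℤ.+ degreeTB t

-- pure combinatorics on words
-- D(word): list of the words appearing (each with coefficient 1)
D1 : Word → List Word
D1 []      = []
D1 (i ∷ w) = (suc i ∷ w) ∷ map (i ∷_) (D1 w)

D'1 : Word → List Word
D'1 []            = []
D'1 (zero ∷ w)    = map (zero ∷_) (D'1 w)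
D'1 (suc i ∷ w)   = (i ∷ w) ∷ map (suc i ∷_) (D'1 w)

redDec : Word → List (Word × Word)
redDec []            = []
redDec (x ∷ [])      = []
redDec (x ∷ y ∷ w)   =
  ((x ∷ []) , (y ∷ w)) ∷ map (λ { (u , v) → ((x ∷ u) , v) }) (redDec (y ∷ w))

-- k-th iterate of the reduced deconcatenation (k = 0 : identity),
-- as the list of tensors  w1 ⊗ ... ⊗ w(k+1)
decIter : ℕ → Word → List (List Word)
decIter zero    w = (w ∷ []) ∷ []
decIter (suc k) w = concatMap (λ { (u , v) → map (u ∷_) (decIter k v) }) (redDec w)

box : ℕ → ℕ → List (List ℕ)
box N zero    = [] ∷ []
box N (suc k) = concatMap (λ j → map (j ∷_) (box N k)) (upTo (suc N))

-- Linear algebra over K: finite formal linear combinations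

module Over {c ℓ} (K : CharZeroField c ℓ) where
  open CharZeroField K public using (Carrier; _≈_; _+_; _*_; 0#; 1#)

  Lin : Set → Set c
  Lin B = List (Carrier × B)

  coeffWith : {B : Set} → DecidableEquality B → Lin B → B → Carrier
  coeffWith _≟_ []            b = 0#
  coeffWith _≟_ ((a , b') ∷ u) b with b' ≟ b
  ... | yes _ = a + coeffWith _≟_ u b
  ... | no  _ = coeffWith _≟_ u b

  -- the pairing for which the basis elements are orthonormal
  pairWith : {B : Set} → DecidableEquality B → Lin B → Lin B → Carrier
  pairWith _≟_ u []             = 0#
  pairWith _≟_ u ((a , b) ∷ v)  = (coeffWith _≟_ u b * a) + pairWith _≟_ u v

  EqWith : {B : Set} → DecidableEquality B → Lin B → Lin B → Set ℓ
  EqWith _≟_ u v = ∀ b → coeffWith _≟_ u b ≈ coeffWith _≟_ v b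

  scale : {B : Set} → Carrier → Lin B → Lin B
  scale a = map (λ { (x , b) → ((a * x) , b) })

  ones : {B : Set} → List B → Lin B
  ones = map (1# ,_)

  lbind : {A B : Set} → (A → Lin B) → Lin A → Lin B
  lbind f = concatMap (λ { (a , x) → scale a (f x) })

  lmul2 : {A B C : Set} → (A → B → C) → Lin A → Lin B → Lin C
  lmul2 f u v = lbind (λ x → lbind (λ y → (1# , f x y) ∷ []) v) u

  iter : ∀ {a} {A : Set a} → ℕ → (A → A) → A → A
  iter zero    f x = x
  iter (suc n) f x = f (iter n f x)

  D : Lin Word → Lin Word
  D = lbind (λ w → ones (D1 w))

  D' : Lin Word → Lin Word
  D' = lbind (λ w → ones (D'1 w))

  -- operadic composition  X_{i1}...X_{in} ∘ (P1,...,Pn) = D^{i1}(P1)...D^{in}(Pn)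
  compW : Word → List (Lin Word) → Lin Word
  compW []       _        = (1# , []) ∷ []
  compW (i ∷ is) []       = []
  compW (i ∷ is) (P ∷ Ps) = lmul2 _++_ (iter i D P) (compW is Ps)

  comp : Lin Word → List (Lin Word) → Lin Word
  comp Q Ps = lbind (λ q → compW q Ps) Q

  bar : List (Lin Word) → Lin TB
  bar []       = (1# , []) ∷ []
  bar (P ∷ Ps) = lmul2 _∷_ P (bar Ps)

  tens : Lin Word → List (Lin Word) → Lin (Word × TB)
  tens Q Qs = lmul2 _,_ Q (bar Qs)

  -- the right-hand side of the formula, with k ∈ {1..N} and each j ∈ {0..N}
  -- (partial sum of the formal infinite sum)
  formulaW : ℕ → Word → Lin (Word × TB)
  formulaW N w =
    concatMap (λ k →
      concatMap (λ ws →
        concatMap (λ js →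
            tens ((1# , js) ∷ [])
                 (zipWith (λ j u → iter j D' ((1# , u) ∷ [])) js ws))
          (box N k))
        (decIter (ℕ.pred k) w))
      (map suc (upTo N))

  formula : ℕ → Lin Word → Lin (Word × TB)
  formula N = lbind (formulaW N)

  Bounds : ℕ → Lin Word → Set c
  Bounds N P = All (λ { (_ , w) → length w ≤ N × weight w ≤ N }) P

  Plus : Lin Word → Set c
  Plus P = All (λ { (_ , w) → Nonempty w }) P

  PlusT : Lin TB → Set c
  PlusT t = All (λ { (_ , ws) → All Nonempty ws }) t

  -- δ_NMI on a word: the formula truncated at a sufficiently large N
  δW : Word → Lin (Word × TB)
  δW w = formulaW (length w ℕ.+ weight w) w

  δT1 : TB → Lin (TB × TB)
  δT1 []      = (1# , ([] , [])) ∷ []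
  δT1 (w ∷ t) = lmul2 (λ { (q , qs) (a , b) → ((q ∷ a) , (qs ++ b)) }) (δW w) (δT1 t)

  δT : Lin TB → Lin (TB × TB)
  δT = lbind δT1

  εW : Word → Carrier
  εW w with w ≟W (0 ∷ [])
  ... | yes _ = 1#
  ... | no  _ = 0#

  ε1 : TB → Carrier
  ε1 []      = 1#
  ε1 (w ∷ t) = εW w * ε1 t

  ε : Lin TB → Carrier
  ε []             = 0#
  ε ((a , t) ∷ u)  = (a * ε1 t) + ε u

  ε⊗Id : Lin (TB × TB) → Lin TB
  ε⊗Id = lbind (λ { (a , b) → (ε1 a , b) ∷ [] })

  Id⊗ε : Lin (TB × TB) → Lin TB
  Id⊗ε = lbind (λ { (a , b) → (ε1 b , a) ∷ [] })

  dX0 : Word → List Word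
  dX0 []          = []
  dX0 (zero ∷ w)  = w ∷ map (zero ∷_) (dX0 w)
  dX0 (suc i ∷ w) = map (suc i ∷_) (dX0 w)

  -- ∂P/∂X_0 evaluated at (0,0,...) : the constant term of ∂P/∂X_0
  dX0at0 : Lin Word → Carrier
  dX0at0 P = coeffWith _≟W_ (lbind (λ w → ones (dX0 w)) P) []

  inT : Lin Word → Lin TB
  inT = map (λ { (a , w) → (a , (w ∷ [])) })

  weightTT : TB × TB → ℕ
  weightTT (a , b) = weightTB a ℕ.+ weightTB b

  degreeTT : TB × TB → ℤ
  degreeTT (a , b) = degreeTB a ℤ.+ degreeTB b

module Submission where

-- Every coefficient and every pairing is a finite sum ⟪ u , g ⟫ of the values of a function g on
-- the words of u, so all three parts reduce to manipulating such sums.  Pairing a term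
-- X_{j₁}⋯X_{jₖ} ⊗ D'^{j₁}w₁|⋯|D'^{jₖ}wₖ of the formula with Q ⊗ Q₁|⋯|Qₖ factorises, because D' is
-- the adjoint of D for the pairing in which words are orthonormal; summing over the splittings
-- w = w₁⋯wₖ given by the iterated reduced deconcatenation is dual to concatenating the factors,
-- which reproduces ⟨ w , D^{j₁}Q₁⋯D^{jₖ}Qₖ ⟩.  The truncation at N loses nothing: D' lowers the
-- weight by one, so only j_i ≤ weight w and k ≤ length w contribute.  For the counit,
-- ε(D'^j u) = [u = X_j], which leaves the single term k = 1, j = 0 on one side and, on the other,
-- the splitting of w into its letters with (j₁,…,jₖ) = w.  Homogeneity holds because the weights
-- of the factors D'^{jᵢ}wᵢ and the indices jᵢ add up to the weight of w.

open import Defs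
open import Level using (Level)
open import Data.Nat using (ℕ; _≤_)
open import Data.Integer using (ℤ)
open import Data.List using (List; length)
open import Data.List.Relation.Unary.All using (All)
open import Data.Product using (_×_; _,_; proj₁)
open import Relation.Nullary using (¬_)
open import Relation.Binary.PropositionalEquality using (_≡_; _≢_)

module Words where
  open import Data.Nat as ℕ using (zero; suc; _+_; z≤n; s≤s)
  import Data.Nat.Properties as ℕP
  import Data.Integer as ℤ
  import Data.Integer.Properties as ℤP
  open import Data.Integer.Tactic.RingSolver using (solve-∀)
  open import Data.List using ([]; _∷_; _++_; map; concat; concatMap)
  import Data.List.Properties as LP
  open import Data.Nat.ListAction using (sum)
  open import Data.Nat.ListAction.Properties using (sum-++)
  open import Data.List.Relation.Unary.All as All using ([]; _∷_)
  open import Data.List.Relation.Unary.All.Properties using (map⁺; concat⁺; applyUpTo⁺₁)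
  open import Data.Product using (proj₂)
  open import Relation.Binary.PropositionalEquality using (refl; sym; trans; cong)
  open import Algebra.Properties.CommutativeSemigroup ℕP.+-commutativeSemigroup
    using () renaming (interchange to +-interchange)

  map⁺-with : ∀ {a b p q} {A : Set a} {B : Set b} {P : A → Set p} {Q : B → Set q} {f : A → B} {xs : List A} →
              (∀ {x} → P x → Q (f x)) → All P xs → All Q (map f xs)
  map⁺-with h ps = map⁺ (All.map h ps)

  concatMap⁺-with : ∀ {a b p q} {A : Set a} {B : Set b} {P : A → Set p} {Q : B → Set q} {f : A → List B} {xs : List A} →
                    (∀ {x} → P x → All Q (f x)) → All P xs → All Q (concatMap f xs)
  concatMap⁺-with h ps = concat⁺ (map⁺-with h ps)

  lengthTB : TB → ℕ
  lengthTB t = sum (map length t)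

  D1-length : ∀ u → All (λ v → length v ≡ length u) (D1 u)
  D1-length []      = []
  D1-length (i ∷ u) = refl ∷ map⁺-with (cong suc) (D1-length u)

  D'1-length-weight : ∀ u → All (λ v → length v ≡ length u × suc (weight v) ≡ weight u) (D'1 u)
  D'1-length-weight []          = []
  D'1-length-weight (zero ∷ u)  = map⁺-with (λ (l , w) → cong suc l , w) (D'1-length-weight u)
  D'1-length-weight (suc i ∷ u) =
    (refl , refl) ∷ map⁺-with (λ {v} (l , w) → cong suc l , cong suc (trans (sym (ℕP.+-suc i (weight v))) (cong (i +_) w)))
                              (D'1-length-weight u)

  redDec-splits : ∀ w → All (λ (u , v) → Nonempty u × Nonempty v × u ++ v ≡ w) (redDec w)
  redDec-splits []          = []
  redDec-splits (x ∷ [])    = []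
  redDec-splits (x ∷ y ∷ w) =
    (s≤s z≤n , s≤s z≤n , refl) ∷ map⁺-with (λ (_ , nv , e) → s≤s z≤n , nv , cong (x ∷_) e) (redDec-splits (y ∷ w))

  decIter-splits : ∀ k w → Nonempty w → All (λ ws → length ws ≡ suc k × All Nonempty ws × concat ws ≡ w) (decIter k w)
  decIter-splits zero    w nw = (refl , nw ∷ [] , LP.++-identityʳ w) ∷ []
  decIter-splits (suc k) w nw = concatMap⁺-with
    (λ { {u , v} (nu , nv , e) → map⁺-with (λ (l , ne , e′) → cong suc l , nu ∷ ne , trans (cong (u ++_) e′) e) (decIter-splits k v nv) })
    (redDec-splits w)

  box-bounded : ∀ N k → All (λ js → length js ≡ k × All (_≤ N) js) (box N k)
  box-bounded N zero    = (refl , []) ∷ []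
  box-bounded N (suc k) = concatMap⁺-with (λ j≤N → map⁺-with (λ (l , a) → cong suc l , j≤N ∷ a) (box-bounded N k))
                                          (applyUpTo⁺₁ (λ i → i) (suc N) (λ { (s≤s i≤N) → i≤N }))

  weightTB-concat : ∀ ws → weightTB ws ≡ weight (concat ws)
  weightTB-concat []       = refl
  weightTB-concat (w ∷ ws) = trans (cong (weight w +_) (weightTB-concat ws)) (sym (sum-++ w (concat ws)))

  lengthTB-concat : ∀ ws → lengthTB ws ≡ length (concat ws)
  lengthTB-concat []       = refl
  lengthTB-concat (w ∷ ws) = trans (cong (length w +_) (lengthTB-concat ws)) (sym (LP.length-++ w))

  weightTB-++ : ∀ a b → weightTB (a ++ b) ≡ weightTB a + weightTB b
  weightTB-++ a b = trans (cong sum (LP.map-++ weight a b)) (sum-++ (map weight a) _)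

  lengthTB-++ : ∀ a b → lengthTB (a ++ b) ≡ lengthTB a + lengthTB b
  lengthTB-++ a b = trans (cong sum (LP.map-++ length a b)) (sum-++ (map length a) _)

  letter≤weight : ∀ w → All (_≤ weight w) w
  letter≤weight []      = []
  letter≤weight (a ∷ w) = ℕP.m≤m+n a (weight w) ∷ All.map (λ x≤ → ℕP.≤-trans x≤ (ℕP.m≤n+m (weight w) a)) (letter≤weight w)

  length≤length-concat : ∀ ws → All Nonempty ws → length ws ≤ length (concat ws)
  length≤length-concat []       []        = z≤n
  length≤length-concat (w ∷ ws) (nw ∷ ne) =
    ℕP.≤-trans (ℕP.+-mono-≤ nw (length≤length-concat ws ne)) (ℕP.≤-reflexive (sym (LP.length-++ w)))

  degreeTB-closed : ∀ t → degreeTB t ≡ (ℤ.+ weightTB t ℤ.- ℤ.+ lengthTB t) ℤ.+ ℤ.+ length t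
  degreeTB-closed []      = refl
  degreeTB-closed (w ∷ t)
    rewrite degreeTB-closed t | ℤP.pos-+ (weight w) (weightTB t) | ℤP.pos-+ (length w) (lengthTB t) | ℤP.pos-+ 1 (length t) =
    regroup (ℤ.+ weight w) (ℤ.+ length w) (ℤ.+ weightTB t) (ℤ.+ lengthTB t) (ℤ.+ length t)
    where
    regroup : ∀ a b d e f → ((a ℤ.- b) ℤ.+ ℤ.+ 1) ℤ.+ ((d ℤ.- e) ℤ.+ f) ≡ ((a ℤ.+ d) ℤ.- (b ℤ.+ e)) ℤ.+ (ℤ.+ 1 ℤ.+ f)
    regroup = solve-∀

  CosplitShape : TB → TB × TB → Set
  CosplitShape t (a , b) =
    weightTB a + weightTB b ≡ weightTB t × lengthTB a ≡ length b × length a ≡ length t × lengthTB b ≡ lengthTB t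

  degreeTB-cosplit : ∀ {t ab} → CosplitShape t ab → degreeTB (proj₁ ab) ℤ.+ degreeTB (proj₂ ab) ≡ degreeTB t
  degreeTB-cosplit {t} {a , b} (wa , la , na , lb)
    rewrite degreeTB-closed a | degreeTB-closed b | degreeTB-closed t
          | sym wa | sym na | sym lb | la | ℤP.pos-+ (weightTB a) (weightTB b) =
    regroup (ℤ.+ weightTB a) (ℤ.+ length b) (ℤ.+ length a) (ℤ.+ weightTB b) (ℤ.+ lengthTB b)
    where
    regroup : ∀ a b d e f → ((a ℤ.- b) ℤ.+ d) ℤ.+ ((e ℤ.- f) ℤ.+ b) ≡ ((a ℤ.+ e) ℤ.- f) ℤ.+ d
    regroup = solve-∀

open Words

module Linear {c ℓ} (K : CharZeroField c ℓ) where
  open import Data.Nat as ℕ using (zero; suc; _<_; z≤n; s≤s)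
  import Data.Nat.Properties as ℕP
  open import Data.List using ([]; _∷_; _++_; map; concat; concatMap; upTo; applyUpTo; zipWith)
  import Data.List.Properties as LP
  open import Data.List.Relation.Unary.All as All using ([]; _∷_)
  open import Data.List.Relation.Unary.All.Properties using (map⁺; concat⁺)
  open import Data.Product using (proj₂)
  import Relation.Binary.PropositionalEquality as ≡
  open import Relation.Binary.Definitions using (DecidableEquality)
  open import Relation.Nullary using (Dec; yes; no)
  open import Data.Empty using (⊥-elim)
  open import Data.Unit using (⊤; tt)
  open import Function using (_∘_)
  open import Level using (_⊔_)
  open import Data.Nat.ListAction using (sum)
  open import Algebra.Properties.CommutativeSemigroup ℕP.+-commutativeSemigroup
    using () renaming (interchange to +-interchangeℕ)

  open CharZeroField K hiding (zero)
  open Over K hiding (Carrier; _≈_; _+_; _*_; 0#; 1#)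
  open import Relation.Binary.Reasoning.Setoid setoid
  open import Algebra.Properties.CommutativeSemigroup +-commutativeSemigroup
    using () renaming (interchange to +-interchange)
  open import Algebra.Properties.CommutativeSemigroup *-commutativeSemigroup
    using () renaming (x∙yz≈y∙xz to *-left-comm)

  -- Finite sums and the pairing ⟪_,_⟫

  ∑ : ∀ {a} {A : Set a} → List A → (A → Carrier) → Carrier
  ∑ []       f = 0#
  ∑ (x ∷ xs) f = f x + ∑ xs f

  ∑-cong : ∀ {a} {A : Set a} (xs : List A) {f g : A → Carrier} → (∀ x → f x ≈ g x) → ∑ xs f ≈ ∑ xs g
  ∑-cong []       e = refl
  ∑-cong (x ∷ xs) e = +-cong (e x) (∑-cong xs e)

  ∑-congᴬ : ∀ {a p} {A : Set a} {P : A → Set p} {xs : List A} {f g : A → Carrier} →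
            All P xs → (∀ {x} → P x → f x ≈ g x) → ∑ xs f ≈ ∑ xs g
  ∑-congᴬ []       e = refl
  ∑-congᴬ (p ∷ ps) e = +-cong (e p) (∑-congᴬ ps e)

  ∑-zero : ∀ {a} {A : Set a} (xs : List A) {f : A → Carrier} → (∀ x → f x ≈ 0#) → ∑ xs f ≈ 0#
  ∑-zero []       e = refl
  ∑-zero (x ∷ xs) e = trans (+-cong (e x) (∑-zero xs e)) (+-identityˡ 0#)

  ∑-zeroᴬ : ∀ {a p} {A : Set a} {P : A → Set p} {xs : List A} {f : A → Carrier} →
            All P xs → (∀ {x} → P x → f x ≈ 0#) → ∑ xs f ≈ 0#
  ∑-zeroᴬ []       e = refl
  ∑-zeroᴬ (p ∷ ps) e = trans (+-cong (e p) (∑-zeroᴬ ps e)) (+-identityˡ 0#)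

  ∑-++ : ∀ {a} {A : Set a} (xs ys : List A) {f : A → Carrier} → ∑ (xs ++ ys) f ≈ ∑ xs f + ∑ ys f
  ∑-++ []       ys = sym (+-identityˡ _)
  ∑-++ (x ∷ xs) ys = trans (+-cong refl (∑-++ xs ys)) (sym (+-assoc _ _ _))

  ∑-map : ∀ {a b} {A : Set a} {B : Set b} (h : A → B) (xs : List A) {f : B → Carrier} → ∑ (map h xs) f ≡ ∑ xs (f ∘ h)
  ∑-map h []       = ≡.refl
  ∑-map h (x ∷ xs) = ≡.cong (_ +_) (∑-map h xs)

  ∑-concatMap : ∀ {a b} {A : Set a} {B : Set b} (h : A → List B) (xs : List A) {f : B → Carrier} →
                ∑ (concatMap h xs) f ≈ ∑ xs (λ x → ∑ (h x) f)
  ∑-concatMap h []       = refl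
  ∑-concatMap h (x ∷ xs) = trans (∑-++ (h x) (concatMap h xs)) (+-cong refl (∑-concatMap h xs))

  ∑-+ : ∀ {a} {A : Set a} (xs : List A) {f g : A → Carrier} → ∑ xs (λ x → f x + g x) ≈ ∑ xs f + ∑ xs g
  ∑-+ []       = sym (+-identityˡ _)
  ∑-+ (x ∷ xs) = trans (+-cong refl (∑-+ xs)) (+-interchange _ _ _ _)

  ∑-*ˡ : ∀ {a} {A : Set a} (xs : List A) (k : Carrier) {f : A → Carrier} → ∑ xs (λ x → k * f x) ≈ k * ∑ xs f
  ∑-*ˡ []       k = sym (zeroʳ k)
  ∑-*ˡ (x ∷ xs) k = trans (+-cong refl (∑-*ˡ xs k)) (sym (distribˡ k _ _))

  ∑-*ʳ : ∀ {a} {A : Set a} (xs : List A) (k : Carrier) {f : A → Carrier} → ∑ xs (λ x → f x * k) ≈ ∑ xs f * k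
  ∑-*ʳ xs k {f} = trans (∑-cong xs (λ x → *-comm (f x) k)) (trans (∑-*ˡ xs k) (*-comm k _))

  ∑-swap : ∀ {a b} {A : Set a} {B : Set b} (xs : List A) (ys : List B) (h : A → B → Carrier) →
           ∑ xs (λ x → ∑ ys (h x)) ≈ ∑ ys (λ y → ∑ xs (λ x → h x y))
  ∑-swap []       ys h = sym (∑-zero ys (λ _ → refl))
  ∑-swap (x ∷ xs) ys h = trans (+-cong refl (∑-swap xs ys h)) (sym (∑-+ ys))

  ⟪_,_⟫ : {B : Set} → Lin B → (B → Carrier) → Carrier
  ⟪ u , g ⟫ = ∑ u (λ (a , x) → a * g x)

  ⟪⟫-cong : {B : Set} (u : Lin B) {g h : B → Carrier} → (∀ x → g x ≈ h x) → ⟪ u , g ⟫ ≈ ⟪ u , h ⟫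
  ⟪⟫-cong u e = ∑-cong u (λ (a , x) → *-cong refl (e x))

  ⟪⟫-congᴬ : ∀ {p} {B : Set} {P : B → Set p} {u : Lin B} {g h : B → Carrier} →
             All (P ∘ proj₂) u → (∀ {x} → P x → g x ≈ h x) → ⟪ u , g ⟫ ≈ ⟪ u , h ⟫
  ⟪⟫-congᴬ ps e = ∑-congᴬ ps (λ px → *-cong refl (e px))

  ⟪⟫-zeroᴬ : ∀ {p} {B : Set} {P : B → Set p} {u : Lin B} {g : B → Carrier} →
             All (P ∘ proj₂) u → (∀ {x} → P x → g x ≈ 0#) → ⟪ u , g ⟫ ≈ 0#
  ⟪⟫-zeroᴬ ps e = ∑-zeroᴬ ps (λ px → trans (*-cong refl (e px)) (zeroʳ _))

  ⟪⟫-*ˡ : {B : Set} (u : Lin B) (k : Carrier) {g : B → Carrier} → ⟪ u , (λ x → k * g x) ⟫ ≈ k * ⟪ u , g ⟫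
  ⟪⟫-*ˡ u k = trans (∑-cong u (λ (a , x) → *-left-comm a k _)) (∑-*ˡ u k)

  ⟪⟫-*ʳ : {B : Set} (u : Lin B) (k : Carrier) {g : B → Carrier} → ⟪ u , (λ x → g x * k) ⟫ ≈ ⟪ u , g ⟫ * k
  ⟪⟫-*ʳ u k {g} = trans (⟪⟫-cong u (λ x → *-comm (g x) k)) (trans (⟪⟫-*ˡ u k) (*-comm k _))

  ⟪⟫-single : {B : Set} (b : B) {g : B → Carrier} → ⟪ (1# , b) ∷ [] , g ⟫ ≈ g b
  ⟪⟫-single b = trans (+-identityʳ _) (*-identityˡ _)

  ⟪⟫-ones : {B : Set} (xs : List B) (g : B → Carrier) → ⟪ ones xs , g ⟫ ≈ ∑ xs g
  ⟪⟫-ones xs g = trans (reflexive (∑-map (1# ,_) xs)) (∑-cong xs (λ x → *-identityˡ _))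

  ⟪⟫-lbind : {A B : Set} (f : A → Lin B) (u : Lin A) {g : B → Carrier} → ⟪ lbind f u , g ⟫ ≈ ⟪ u , (λ x → ⟪ f x , g ⟫) ⟫
  ⟪⟫-lbind f u {g} = trans (∑-concatMap _ u) (∑-cong u (λ (a , x) → scaled a (f x)))
    where
    scaled : ∀ a v → ⟪ scale a v , g ⟫ ≈ a * ⟪ v , g ⟫
    scaled a v = trans (reflexive (∑-map _ v)) (trans (∑-cong v (λ (b , y) → *-assoc a b (g y))) (∑-*ˡ v a))

  ⟪⟫-lmul2 : {A B C : Set} (f : A → B → C) (u : Lin A) (v : Lin B) {g : C → Carrier} →
             ⟪ lmul2 f u v , g ⟫ ≈ ⟪ u , (λ x → ⟪ v , (λ y → g (f x y)) ⟫) ⟫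
  ⟪⟫-lmul2 f u v {g} =
    trans (⟪⟫-lbind _ u) (⟪⟫-cong u (λ x → trans (⟪⟫-lbind (λ y → (1# , f x y) ∷ []) v) (⟪⟫-cong v (λ y → ⟪⟫-single (f x y) {g}))))

  ∑-⟪⟫-swap : ∀ {a} {A : Set a} {B : Set} (xs : List A) (v : Lin B) (h : A → B → Carrier) →
              ∑ xs (λ x → ⟪ v , h x ⟫) ≈ ⟪ v , (λ y → ∑ xs (λ x → h x y)) ⟫
  ∑-⟪⟫-swap xs v h = trans (∑-swap xs v _) (∑-cong v (λ (b , y) → ∑-*ˡ xs b))

  ⟪⟫-swap : {A B : Set} (u : Lin A) (v : Lin B) (h : A → B → Carrier) →
            ⟪ u , (λ x → ⟪ v , h x ⟫) ⟫ ≈ ⟪ v , (λ y → ⟪ u , (λ x → h x y) ⟫) ⟫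
  ⟪⟫-swap u v h = trans (∑-cong u (λ (a , x) → sym (⟪⟫-*ˡ v a))) (∑-⟪⟫-swap u v (λ (a , x) y → a * h x y))

  δ : {B : Set} → DecidableEquality B → B → B → Carrier
  δ _≟_ b x with x ≟ b
  ... | yes _ = 1#
  ... | no  _ = 0#

  δ-≡ : {B : Set} (_≟_ : DecidableEquality B) {b x : B} → x ≡ b → δ _≟_ b x ≈ 1#
  δ-≡ _≟_ {b} {x} x≡b with x ≟ b
  ... | yes _   = refl
  ... | no  x≢b = ⊥-elim (x≢b x≡b)

  δ-≢ : {B : Set} (_≟_ : DecidableEquality B) {b x : B} → x ≢ b → δ _≟_ b x ≈ 0#
  δ-≢ _≟_ {b} {x} x≢b with x ≟ b
  ... | yes x≡b = ⊥-elim (x≢b x≡b)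
  ... | no  _   = refl

  δ-refl : {B : Set} (_≟_ : DecidableEquality B) (b : B) → δ _≟_ b b ≈ 1#
  δ-refl _≟_ b = δ-≡ _≟_ ≡.refl

  δ-sym : {B : Set} (_≟_ _≟′_ : DecidableEquality B) (b x : B) → δ _≟_ b x ≈ δ _≟′_ x b
  δ-sym _≟_ _≟′_ b x with x ≟ b
  ... | yes x≡b = sym (δ-≡ _≟′_ (≡.sym x≡b))
  ... | no  x≢b = sym (δ-≢ _≟′_ (x≢b ∘ ≡.sym))

  coeff≈⟪δ⟫ : {B : Set} (_≟_ : DecidableEquality B) (u : Lin B) (b : B) → coeffWith _≟_ u b ≈ ⟪ u , δ _≟_ b ⟫
  coeff≈⟪δ⟫ _≟_ []             b = refl
  coeff≈⟪δ⟫ _≟_ ((a , b′) ∷ u) b with b′ ≟ b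
  ... | yes _ = +-cong (sym (*-identityʳ a)) (coeff≈⟪δ⟫ _≟_ u b)
  ... | no  _ = trans (coeff≈⟪δ⟫ _≟_ u b) (trans (sym (+-identityˡ _)) (+-cong (sym (zeroʳ a)) refl))

  pair≈⟪⟫ : {B : Set} (_≟_ : DecidableEquality B) (u v : Lin B) → pairWith _≟_ u v ≈ ⟪ v , (λ b → ⟪ u , δ _≟_ b ⟫) ⟫
  pair≈⟪⟫ _≟_ u []            = refl
  pair≈⟪⟫ _≟_ u ((a , b) ∷ v) = +-cong (trans (*-comm _ a) (*-cong refl (coeff≈⟪δ⟫ _≟_ u b))) (pair≈⟪⟫ _≟_ u v)

  δ-∷ : {A : Set} (_≟_ : DecidableEquality A) (_≟ₗ_ : DecidableEquality (List A)) (x y : A) (xs ys : List A) →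
        δ _≟ₗ_ (x ∷ xs) (y ∷ ys) ≈ δ _≟_ x y * δ _≟ₗ_ xs ys
  δ-∷ _≟_ _≟ₗ_ x y xs ys = cases (y ≟ x) (ys ≟ₗ xs)
    where
    cases : Dec (y ≡ x) → Dec (ys ≡ xs) → δ _≟ₗ_ (x ∷ xs) (y ∷ ys) ≈ δ _≟_ x y * δ _≟ₗ_ xs ys
    cases (yes ≡.refl) (yes ≡.refl) = trans (δ-refl _≟ₗ_ _) (sym (trans (*-cong (δ-refl _≟_ x) (δ-refl _≟ₗ_ xs)) (*-identityˡ _)))
    cases (yes ≡.refl) (no ys≢xs)   =
      trans (δ-≢ _≟ₗ_ (ys≢xs ∘ proj₂ ∘ LP.∷-injective)) (sym (trans (*-cong refl (δ-≢ _≟ₗ_ ys≢xs)) (zeroʳ _)))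
    cases (no y≢x)     _            =
      trans (δ-≢ _≟ₗ_ (y≢x ∘ proj₁ ∘ LP.∷-injective)) (sym (trans (*-cong (δ-≢ _≟_ y≢x) refl) (zeroˡ _)))

  δ-, : {A B : Set} (_≟ᴬ_ : DecidableEquality A) (_≟ᴮ_ : DecidableEquality B) (_≟_ : DecidableEquality (A × B))
        (a x : A) (b y : B) → δ _≟_ (a , b) (x , y) ≈ δ _≟ᴬ_ a x * δ _≟ᴮ_ b y
  δ-, _≟ᴬ_ _≟ᴮ_ _≟_ a x b y = cases (x ≟ᴬ a) (y ≟ᴮ b)
    where
    cases : Dec (x ≡ a) → Dec (y ≡ b) → δ _≟_ (a , b) (x , y) ≈ δ _≟ᴬ_ a x * δ _≟ᴮ_ b y
    cases (yes ≡.refl) (yes ≡.refl) = trans (δ-refl _≟_ _) (sym (trans (*-cong (δ-refl _≟ᴬ_ a) (δ-refl _≟ᴮ_ b)) (*-identityˡ _)))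
    cases (yes ≡.refl) (no y≢b)     =
      trans (δ-≢ _≟_ (λ { ≡.refl → y≢b ≡.refl })) (sym (trans (*-cong refl (δ-≢ _≟ᴮ_ y≢b)) (zeroʳ _)))
    cases (no x≢a)     _            =
      trans (δ-≢ _≟_ (λ { ≡.refl → x≢a ≡.refl })) (sym (trans (*-cong (δ-≢ _≟ᴬ_ x≢a) refl) (zeroˡ _)))

  δ-suc : ∀ a b → δ ℕ._≟_ (suc a) (suc b) ≈ δ ℕ._≟_ a b
  δ-suc a b = cases (b ℕ.≟ a)
    where
    cases : Dec (b ≡ a) → δ ℕ._≟_ (suc a) (suc b) ≈ δ ℕ._≟_ a b
    cases (yes ≡.refl) = trans (δ-refl ℕ._≟_ (suc a)) (sym (δ-refl ℕ._≟_ a))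
    cases (no b≢a)     = trans (δ-≢ ℕ._≟_ (b≢a ∘ ℕP.suc-injective)) (sym (δ-≢ ℕ._≟_ b≢a))

  -- Supports: admissibility and homogeneity

  Supp : ∀ {p} {X : Set} → (X → Set p) → Lin X → Set (c ⊔ p)
  Supp P u = All (P ∘ proj₂) u

  supp-ones : ∀ {p} {X : Set} {P : X → Set p} {xs : List X} → All P xs → Supp P (ones xs)
  supp-ones = map⁺-with (λ px → px)

  supp-lbind : ∀ {p q} {X Y : Set} {P : X → Set p} {Q : Y → Set q} {f : X → Lin Y} {u : Lin X} →
               (∀ {x} → P x → Supp Q (f x)) → Supp P u → Supp Q (lbind f u)
  supp-lbind h = concatMap⁺-with (λ px → map⁺-with (λ qy → qy) (h px))

  supp-lmul2 : ∀ {p q r} {X Y Z : Set} {P : X → Set p} {Q : Y → Set q} {R : Z → Set r} {f : X → Y → Z} {u : Lin X} {v : Lin Y} →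
               (∀ {x y} → P x → Q y → R (f x y)) → Supp P u → Supp Q v → Supp R (lmul2 f u v)
  supp-lmul2 h su sv = supp-lbind (λ px → supp-lbind (λ qy → h px qy ∷ []) sv) su

  coeff-outside-supp : ∀ {p} {X : Set} {P : X → Set p} (_≟_ : DecidableEquality X) {u : Lin X} →
                       Supp P u → (b : X) → ¬ P b → coeffWith _≟_ u b ≈ 0#
  coeff-outside-supp _≟_ {u} s b ¬Pb = trans (coeff≈⟪δ⟫ _≟_ u b) (⟪⟫-zeroᴬ s (λ px → δ-≢ _≟_ (λ { ≡.refl → ¬Pb px })))

  D'-iter : ℕ → Word → Lin Word
  D'-iter j u = iter j D' ((1# , u) ∷ [])

  D'⊗ : List ℕ → List Word → List (Lin Word)
  D'⊗ = zipWith D'-iter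

  D'-iter-supp : ∀ j u → Supp (λ v → length v ≡ length u × weight v ℕ.+ j ≡ weight u) (D'-iter j u)
  D'-iter-supp zero    u = (≡.refl , ℕP.+-identityʳ _) ∷ []
  D'-iter-supp (suc j) u = supp-lbind
    (λ {x} (l , e) → supp-ones (All.map (λ {v} (l′ , e′) → ≡.trans l′ l , ≡.trans (ℕP.+-suc (weight v) j) (≡.trans (≡.cong (ℕ._+ j) e′) e))
                                        (D'1-length-weight x)))
    (D'-iter-supp j u)

  bar-D'⊗-supp : ∀ js ws → length js ≡ length ws → All Nonempty ws →
    Supp (λ t → length t ≡ length js × All Nonempty t × weightTB t ℕ.+ sum js ≡ weightTB ws × lengthTB t ≡ lengthTB ws) (bar (D'⊗ js ws))
  bar-D'⊗-supp []       []       _ _         = (≡.refl , [] , ≡.refl , ≡.refl) ∷ []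
  bar-D'⊗-supp (j ∷ js) (u ∷ ws) l (nu ∷ ne) = supp-lmul2
    (λ {v} {t} (lv , ev) (lt , net , et , llt) →
      ≡.cong suc lt , ≡.subst (1 ≤_) (≡.sym lv) nu ∷ net ,
      ≡.trans (+-interchangeℕ (weight v) (weightTB t) j (sum js)) (≡.cong₂ ℕ._+_ ev et) , ≡.cong₂ ℕ._+_ lv llt)
    (D'-iter-supp j u) (bar-D'⊗-supp js ws (ℕP.suc-injective l) ne)

  FormulaShape : Word → Word × TB → Set
  FormulaShape w (q , qs) =
    Nonempty q × All Nonempty qs × length q ≡ length qs × weight q ℕ.+ weightTB qs ≡ weight w × lengthTB qs ≡ length w

  formulaW-supp : ∀ N w → Nonempty w → Supp (FormulaShape w) (formulaW N w)
  formulaW-supp N w nw = concat⁺ (map⁺ (map⁺ (All.universal (λ k →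
    concatMap⁺-with (λ {ws} (lw , nws , cw) → concatMap⁺-with (λ {js} (lj , _) →
        supp-lmul2 {P = _≡ js} {R = FormulaShape w} {f = _,_}
          (λ { ≡.refl (lt , net , et , llt) →
               ≡.subst (1 ≤_) (≡.sym lj) (s≤s z≤n) , net , ≡.sym lt ,
               ≡.trans (ℕP.+-comm (sum js) _) (≡.trans et (≡.trans (weightTB-concat ws) (≡.cong weight cw))) ,
               ≡.trans llt (≡.trans (lengthTB-concat ws) (≡.cong length cw)) })
          (≡.refl ∷ []) (bar-D'⊗-supp js ws (≡.trans lj (≡.sym lw)) nws))
        (box-bounded N (suc k)))
      (decIter-splits k w nw))
    (upTo N))))

  formula-supp : ∀ N P → Plus P → (q : Word) (qs : TB) →
                 ¬ (Nonempty q × All Nonempty qs × length q ≡ length qs) → coeffWith _≟WT_ (formula N P) (q , qs) ≈ 0#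
  formula-supp N P plus q qs = coeff-outside-supp _≟WT_
    (supp-lbind (λ {w} nw → All.map (λ (nq , nqs , l , _) → nq , nqs , l) (formulaW-supp N w nw)) plus) (q , qs)

  δT1-supp : ∀ t → All Nonempty t → Supp (CosplitShape t) (δT1 t)
  δT1-supp []      []        = (≡.refl , ≡.refl , ≡.refl , ≡.refl) ∷ []
  δT1-supp (w ∷ t) (nw ∷ nt) = supp-lmul2
    (λ { {q , qs} {a , b} (_ , _ , lq , wq , lqs) (wa , la , na , lb) →
         ≡.trans (≡.cong (weight q ℕ.+ weightTB a ℕ.+_) (weightTB-++ qs b))
                 (≡.trans (+-interchangeℕ (weight q) (weightTB a) (weightTB qs) (weightTB b)) (≡.cong₂ ℕ._+_ wq wa)) ,
         ≡.trans (≡.cong₂ ℕ._+_ lq la) (≡.sym (LP.length-++ qs)) ,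
         ≡.cong suc na ,
         ≡.trans (lengthTB-++ qs b) (≡.cong₂ ℕ._+_ lqs lb) })
    (formulaW-supp (length w ℕ.+ weight w) w nw) (δT1-supp t nt)

  δT-homogeneous : ∀ {A : Set} (gr : TB → A) (gr₂ : TB × TB → A) → (∀ {t ab} → CosplitShape t ab → gr₂ ab ≡ gr t) →
    ∀ n (t : Lin TB) → PlusT t → All (λ (_ , b) → gr b ≡ n) t → ∀ ab → gr₂ ab ≢ n → coeffWith _≟TT_ (δT t) ab ≈ 0#
  δT-homogeneous gr gr₂ gr₂≡gr n t plus graded ab = coeff-outside-supp _≟TT_
    (supp-lbind {P = λ x → All Nonempty x × gr x ≡ n}
                (λ {x} (nx , gx) → All.map (λ {(_ , ab)} shape → ≡.trans (gr₂≡gr {x} {ab} shape) gx) (δT1-supp x nx))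
                (All.zip (plus , graded)))
    ab

  ∑< : ℕ → (ℕ → Carrier) → Carrier
  ∑< zero    F = 0#
  ∑< (suc n) F = F 0 + ∑< n (F ∘ suc)

  ∑-applyUpTo : ∀ (f : ℕ → ℕ) n (F : ℕ → Carrier) → ∑ (applyUpTo f n) F ≡ ∑< n (F ∘ f)
  ∑-applyUpTo f zero    F = ≡.refl
  ∑-applyUpTo f (suc n) F = ≡.cong (F (f 0) +_) (∑-applyUpTo (f ∘ suc) n F)

  ∑<-cong : ∀ n {F G : ℕ → Carrier} → (∀ i → F i ≈ G i) → ∑< n F ≈ ∑< n G
  ∑<-cong zero    e = refl
  ∑<-cong (suc n) e = +-cong (e 0) (∑<-cong n (e ∘ suc))

  ∑<-zero : ∀ n {F : ℕ → Carrier} → (∀ i → F i ≈ 0#) → ∑< n F ≈ 0#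
  ∑<-zero zero    e = refl
  ∑<-zero (suc n) e = trans (+-cong (e 0) (∑<-zero n (e ∘ suc))) (+-identityʳ _)

  private
    shift : ∀ {a} {F : ℕ → Carrier} → (∀ i → i ≢ suc a → F i ≈ 0#) → ∀ i → i ≢ a → F (suc i) ≈ 0#
    shift e i i≢a = e (suc i) (i≢a ∘ ℕP.suc-injective)

  ∑<-single : ∀ n a {F : ℕ → Carrier} → a < n → (∀ i → i ≢ a → F i ≈ 0#) → ∑< n F ≈ F a
  ∑<-single (suc n) zero    _         e = trans (+-cong refl (∑<-zero n (λ i → e (suc i) (λ ())))) (+-identityʳ _)
  ∑<-single (suc n) (suc a) (s≤s a<n) e = trans (+-cong (e 0 (λ ())) (∑<-single n a a<n (shift e))) (+-identityˡ _)

  ∑<-single-outside : ∀ n a {F : ℕ → Carrier} → ¬ a < n → (∀ i → i ≢ a → F i ≈ 0#) → ∑< n F ≈ 0#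
  ∑<-single-outside zero    a       _   e = refl
  ∑<-single-outside (suc n) zero    a≮n e = ⊥-elim (a≮n (s≤s z≤n))
  ∑<-single-outside (suc n) (suc a) a≮n e =
    trans (+-cong (e 0 (λ ())) (∑<-single-outside n a (a≮n ∘ s≤s) (shift e))) (+-identityˡ _)

  ∑-box-suc : ∀ N k (f : List ℕ → Carrier) → ∑ (box N (suc k)) f ≈ ∑< (suc N) (λ j → ∑ (box N k) (λ js → f (j ∷ js)))
  ∑-box-suc N k f = begin
    ∑ (box N (suc k)) f
      ≈⟨ ∑-concatMap (λ j → map (j ∷_) (box N k)) (upTo (suc N)) ⟩
    ∑ (upTo (suc N)) (λ j → ∑ (map (j ∷_) (box N k)) f)
      ≡⟨ ∑-applyUpTo (λ i → i) (suc N) _ ⟩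
    ∑< (suc N) (λ j → ∑ (map (j ∷_) (box N k)) f)
      ≈⟨ ∑<-cong (suc N) (λ j → reflexive (∑-map (j ∷_) (box N k) {f})) ⟩
    ∑< (suc N) (λ j → ∑ (box N k) (λ js → f (j ∷ js)))
      ∎

  ∑-box-δ-suc : ∀ N k x r (H : List ℕ → Carrier) →
    ∑ (box N (suc k)) (λ js → δ _≟W_ (x ∷ r) js * H js) ≈
    ∑< (suc N) (λ j → δ ℕ._≟_ x j * ∑ (box N k) (λ js → δ _≟W_ r js * H (j ∷ js)))
  ∑-box-δ-suc N k x r H = trans (∑-box-suc N k (λ js → δ _≟W_ (x ∷ r) js * H js)) (∑<-cong (suc N) (λ j →
    trans (∑-cong (box N k) (λ js → trans (*-cong (δ-∷ ℕ._≟_ _≟W_ x j r js) refl) (*-assoc _ _ _)))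
          (∑-*ˡ (box N k) (δ ℕ._≟_ x j) {λ js → δ _≟W_ r js * H (j ∷ js)})))

  ∑-box-δ : ∀ N k r (H : List ℕ → Carrier) → length r ≡ k → All (_≤ N) r → ∑ (box N k) (λ js → δ _≟W_ r js * H js) ≈ H r
  ∑-box-δ N zero    []      H _ _          = trans (+-identityʳ _) (trans (*-cong (δ-refl _≟W_ []) refl) (*-identityˡ _))
  ∑-box-δ N (suc k) (x ∷ r) H l (x≤N ∷ r≤N) = begin
    ∑ (box N (suc k)) (λ js → δ _≟W_ (x ∷ r) js * H js)
      ≈⟨ ∑-box-δ-suc N k x r H ⟩
    ∑< (suc N) (λ j → δ ℕ._≟_ x j * rest j)
      ≈⟨ ∑<-cong (suc N) {λ j → δ ℕ._≟_ x j * rest j} {λ j → δ ℕ._≟_ x j * H (j ∷ r)}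
        (λ j → *-congˡ (∑-box-δ N k r (λ js → H (j ∷ js)) (ℕP.suc-injective l) r≤N)) ⟩
    ∑< (suc N) (λ j → δ ℕ._≟_ x j * H (j ∷ r))
      ≈⟨ ∑<-single (suc N) x {λ j → δ ℕ._≟_ x j * H (j ∷ r)} (s≤s x≤N)
        (λ i i≢x → trans (*-cong (δ-≢ ℕ._≟_ {x} {i} i≢x) refl) (zeroˡ _)) ⟩
    δ ℕ._≟_ x x * H (x ∷ r)
      ≈⟨ trans (*-cong (δ-refl ℕ._≟_ x) refl) (*-identityˡ _) ⟩
    H (x ∷ r)
      ∎
    where
    rest : ℕ → Carrier
    rest j = ∑ (box N k) (λ js → δ _≟W_ r js * H (j ∷ js))

  ∑-box-δ-outside : ∀ N k r (H : List ℕ → Carrier) → ¬ (length r ≡ k × All (_≤ N) r) →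
                    ∑ (box N k) (λ js → δ _≟W_ r js * H js) ≈ 0#
  ∑-box-δ-outside N zero    []      H r∉ = ⊥-elim (r∉ (≡.refl , []))
  ∑-box-δ-outside N zero    (x ∷ r) H r∉ = trans (+-identityʳ _) (trans (*-cong (δ-≢ _≟W_ {x ∷ r} {[]} (λ ())) refl) (zeroˡ _))
  ∑-box-δ-outside N (suc k) []      H r∉ = trans (∑-box-suc N k (λ js → δ _≟W_ [] js * H js))
    (∑<-zero (suc N) {λ j → ∑ (box N k) (λ js → δ _≟W_ [] (j ∷ js) * H (j ∷ js))}
      (λ j → ∑-zero (box N k) (λ js → trans (*-cong (δ-≢ _≟W_ {[]} {j ∷ js} (λ ())) refl) (zeroˡ _))))
  ∑-box-δ-outside N (suc k) (x ∷ r) H r∉ = trans (∑-box-δ-suc N k x r H) (cases (x ℕ.≤? N))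
    where
    rest : ℕ → Carrier
    rest j = ∑ (box N k) (λ js → δ _≟W_ r js * H (j ∷ js))
    cases : Dec (x ≤ N) → ∑< (suc N) (λ j → δ ℕ._≟_ x j * rest j) ≈ 0#
    cases (yes x≤N) = ∑<-zero (suc N) {λ j → δ ℕ._≟_ x j * rest j}
      (λ j → trans (*-congˡ (∑-box-δ-outside N k r (λ js → H (j ∷ js)) (λ (l , r≤N) → r∉ (≡.cong suc l , x≤N ∷ r≤N)))) (zeroʳ _))
    cases (no x≰N)  = ∑<-single-outside (suc N) x {λ j → δ ℕ._≟_ x j * rest j} (λ { (s≤s x≤N) → x≰N x≤N })
      (λ i i≢x → trans (*-cong (δ-≢ ℕ._≟_ {x} {i} i≢x) refl) (zeroˡ _))

  ⟪formulaW⟫-expand : ∀ N w (G : Word × TB → Carrier) → ⟪ formulaW N w , G ⟫ ≈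
    ∑< N (λ k → ∑ (decIter k w) (λ ws → ∑ (box N (suc k)) (λ js → ⟪ bar (D'⊗ js ws) , (λ t → G (js , t)) ⟫)))
  ⟪formulaW⟫-expand N w G = begin
    ⟪ formulaW N w , G ⟫
      ≈⟨ ∑-concatMap termsOf (map suc (upTo N)) ⟩
    ∑ (map suc (upTo N)) (λ k → ⟪ termsOf k , G ⟫)
      ≡⟨ ≡.trans (∑-map suc (upTo N)) (∑-applyUpTo (λ i → i) N _) ⟩
    ∑< N (λ k → ⟪ termsOf (suc k) , G ⟫)
      ≈⟨ ∑<-cong N (λ k → trans (∑-concatMap _ (decIter k w))
        (∑-cong (decIter k w) (λ ws → trans (∑-concatMap _ (box N (suc k)))
        (∑-cong (box N (suc k)) (λ js → tensor-term js ws))))) ⟩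
    ∑< N (λ k → ∑ (decIter k w) (λ ws → ∑ (box N (suc k)) (λ js → ⟪ bar (D'⊗ js ws) , (λ t → G (js , t)) ⟫))) ∎
    where
    termsOf : ℕ → Lin (Word × TB)
    termsOf k = concatMap (λ ws → concatMap (λ js → tens ((1# , js) ∷ []) (D'⊗ js ws)) (box N k)) (decIter (ℕ.pred k) w)
    tensor-term : ∀ js ws → ⟪ tens ((1# , js) ∷ []) (D'⊗ js ws) , G ⟫ ≈ ⟪ bar (D'⊗ js ws) , (λ t → G (js , t)) ⟫
    tensor-term js ws = trans (⟪⟫-lmul2 _,_ ((1# , js) ∷ []) (bar (D'⊗ js ws)) {G})
                              (⟪⟫-single js {λ x → ⟪ bar (D'⊗ js ws) , (λ t → G (x , t)) ⟫})

  -- The counit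

  εW≈δ : ∀ w → εW w ≈ δ _≟W_ (0 ∷ []) w
  εW≈δ w with w ≟W (0 ∷ [])
  ... | yes _ = refl
  ... | no  _ = refl

  D'-iter-letter : ∀ j m (g : Word → Carrier) → ⟪ D'-iter j ((j ℕ.+ m) ∷ []) , g ⟫ ≈ g (m ∷ [])
  D'-iter-letter zero    m g = ⟪⟫-single (m ∷ []) {g}
  D'-iter-letter (suc j) m g rewrite ≡.sym (ℕP.+-suc j m) =
    trans (⟪⟫-lbind (λ w → ones (D'1 w)) (D'-iter j ((j ℕ.+ suc m) ∷ [])) {g})
          (trans (D'-iter-letter j (suc m) (λ v → ⟪ ones (D'1 v) , g ⟫)) (⟪⟫-single (m ∷ []) {g}))

  ε-D'-iter : ∀ j u → ⟪ D'-iter j u , εW ⟫ ≈ δ _≟W_ (j ∷ []) u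
  ε-D'-iter j u = cases (u ≟W (j ∷ []))
    where
    letter : ∀ u → length u ≡ 1 → weight u ≡ j → u ≡ j ∷ []
    letter (a ∷ []) _ e = ≡.cong (_∷ []) (≡.trans (≡.sym (ℕP.+-identityʳ a)) e)
    cases : Dec (u ≡ j ∷ []) → ⟪ D'-iter j u , εW ⟫ ≈ δ _≟W_ (j ∷ []) u
    cases (yes ≡.refl) = begin
      ⟪ D'-iter j (j ∷ []) , εW ⟫
        ≡⟨ ≡.cong (λ i → ⟪ D'-iter j (i ∷ []) , εW ⟫) (≡.sym (ℕP.+-identityʳ j)) ⟩
      ⟪ D'-iter j ((j ℕ.+ 0) ∷ []) , εW ⟫
        ≈⟨ D'-iter-letter j 0 εW ⟩
      εW (0 ∷ [])
        ≈⟨ trans (εW≈δ (0 ∷ [])) (trans (δ-refl _≟W_ (0 ∷ [])) (sym (δ-refl _≟W_ (j ∷ [])))) ⟩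
      δ _≟W_ (j ∷ []) (j ∷ [])
        ∎
    cases (no u≢j) =
      trans (⟪⟫-zeroᴬ (D'-iter-supp j u) (λ {v} (l , e) →
               trans (εW≈δ v) (δ-≢ _≟W_ {0 ∷ []} {v} (λ { ≡.refl → u≢j (letter u (≡.sym l) (≡.sym e)) }))))
            (sym (δ-≢ _≟W_ u≢j))

  singletons : List ℕ → TB
  singletons = map (_∷ [])

  ε-bar-D'⊗ : ∀ js ws → length js ≡ length ws → ⟪ bar (D'⊗ js ws) , ε1 ⟫ ≈ δ _≟TB_ (singletons js) ws
  ε-bar-D'⊗ []       []       _ = trans (⟪⟫-single [] {ε1}) (sym (δ-refl _≟TB_ []))
  ε-bar-D'⊗ (j ∷ js) (u ∷ ws) l = begin
    ⟪ bar (D'⊗ (j ∷ js) (u ∷ ws)) , ε1 ⟫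
      ≈⟨ ⟪⟫-lmul2 _∷_ (D'-iter j u) (bar (D'⊗ js ws)) {ε1} ⟩
    ⟪ D'-iter j u , (λ v → ⟪ bar (D'⊗ js ws) , (λ t → εW v * ε1 t) ⟫) ⟫
      ≈⟨ ⟪⟫-cong (D'-iter j u) (λ v → ⟪⟫-*ˡ (bar (D'⊗ js ws)) (εW v)) ⟩
    ⟪ D'-iter j u , (λ v → εW v * ⟪ bar (D'⊗ js ws) , ε1 ⟫) ⟫
      ≈⟨ ⟪⟫-*ʳ (D'-iter j u) _ ⟩
    ⟪ D'-iter j u , εW ⟫ * ⟪ bar (D'⊗ js ws) , ε1 ⟫
      ≈⟨ *-cong (ε-D'-iter j u) (ε-bar-D'⊗ js ws (ℕP.suc-injective l)) ⟩
    δ _≟W_ (j ∷ []) u * δ _≟TB_ (singletons js) ws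
      ≈⟨ δ-∷ _≟W_ _≟TB_ (j ∷ []) u (singletons js) ws ⟨
    δ _≟TB_ (singletons (j ∷ js)) (u ∷ ws)
      ∎

  singletons-injective : ∀ a b → singletons a ≡ singletons b → a ≡ b
  singletons-injective []      []      _ = ≡.refl
  singletons-injective (x ∷ a) (y ∷ b) e =
    ≡.cong₂ _∷_ (LP.∷-injectiveˡ (LP.∷-injectiveˡ e)) (singletons-injective a b (LP.∷-injectiveʳ e))

  concat-singletons : ∀ a → concat (singletons a) ≡ a
  concat-singletons []      = ≡.refl
  concat-singletons (x ∷ a) = ≡.cong (x ∷_) (concat-singletons a)

  δ-singletons : ∀ a b → δ _≟TB_ (singletons a) (singletons b) ≈ δ _≟W_ b a
  δ-singletons a b = cases (b ≟W a)
    where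
    cases : Dec (b ≡ a) → δ _≟TB_ (singletons a) (singletons b) ≈ δ _≟W_ b a
    cases (yes ≡.refl) = trans (δ-refl _≟TB_ (singletons a)) (sym (δ-refl _≟W_ a))
    cases (no b≢a)     = trans (δ-≢ _≟TB_ (b≢a ∘ singletons-injective b a)) (sym (δ-≢ _≟W_ {b} {a} (b≢a ∘ ≡.sym)))

  ∑-decIter-singletons-other : ∀ k w → Nonempty w → suc k ≢ length w → ∑ (decIter k w) (δ _≟TB_ (singletons w)) ≈ 0#
  ∑-decIter-singletons-other k w nw k≢ =
    ∑-zeroᴬ (decIter-splits k w nw) (λ {ws} (l , _ , _) →
      δ-≢ _≟TB_ {singletons w} {ws} (λ { ≡.refl → k≢ (≡.trans (≡.sym l) (LP.length-map _ w)) }))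

  ∑-decIter-singletons : ∀ w → Nonempty w → ∑ (decIter (ℕ.pred (length w)) w) (δ _≟TB_ (singletons w)) ≈ 1#
  ∑-decIter-singletons (a ∷ [])      _ = trans (+-identityʳ _) (δ-refl _≟TB_ (singletons (a ∷ [])))
  ∑-decIter-singletons (a ∷ b ∷ w′) _ = begin
    ∑ (map ((a ∷ []) ∷_) (decIter n (b ∷ w′)) ++ concatMap h (map m (redDec (b ∷ w′)))) f
      ≈⟨ ∑-++ (map ((a ∷ []) ∷_) (decIter n (b ∷ w′))) _ ⟩
    ∑ (map ((a ∷ []) ∷_) (decIter n (b ∷ w′))) f + ∑ (concatMap h (map m (redDec (b ∷ w′)))) f
      ≈⟨ +-cong (first-letter-alone (∑-decIter-singletons (b ∷ w′) (s≤s z≤n))) later-splits ⟩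
    1# + 0#
      ≈⟨ +-identityʳ 1# ⟩
    1#
      ∎
    where
    n = length w′
    f = δ _≟TB_ (singletons (a ∷ b ∷ w′))
    h : Word × Word → List TB
    h (u , v) = map (u ∷_) (decIter n v)
    m : Word × Word → Word × Word
    m (u , v) = (a ∷ u) , v
    first-letter-alone : ∑ (decIter n (b ∷ w′)) (δ _≟TB_ (singletons (b ∷ w′))) ≈ 1# →
                         ∑ (map ((a ∷ []) ∷_) (decIter n (b ∷ w′))) f ≈ 1#
    first-letter-alone ih = begin
      ∑ (map ((a ∷ []) ∷_) (decIter n (b ∷ w′))) f
        ≡⟨ ∑-map ((a ∷ []) ∷_) (decIter n (b ∷ w′)) ⟩
      ∑ (decIter n (b ∷ w′)) (λ ws → f ((a ∷ []) ∷ ws))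
        ≈⟨ ∑-cong (decIter n (b ∷ w′)) (λ ws →
          trans (δ-∷ _≟W_ _≟TB_ (a ∷ []) (a ∷ []) _ ws)
          (trans (*-cong (δ-refl _≟W_ (a ∷ [])) refl) (*-identityˡ _))) ⟩
      ∑ (decIter n (b ∷ w′)) (δ _≟TB_ (singletons (b ∷ w′)))
        ≈⟨ ih ⟩
      1#
        ∎
    later-splits : ∑ (concatMap h (map m (redDec (b ∷ w′)))) f ≈ 0#
    later-splits = trans (∑-concatMap h (map m (redDec (b ∷ w′))))
      (trans (reflexive (∑-map m (redDec (b ∷ w′))))
        (∑-zeroᴬ (redDec-splits (b ∷ w′)) (λ { {u , v} (nu , _) → trans (reflexive (∑-map ((a ∷ u) ∷_) (decIter n v)))
          (∑-zero (decIter n v) (λ ws → δ-≢ _≟TB_ (λ e → first-not-singleton u nu (LP.∷-injectiveˡ e)))) })))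
      where
      first-not-singleton : ∀ u → Nonempty u → (a ∷ u) ≢ (a ∷ [])
      first-not-singleton (_ ∷ _) _ ()

  ∑-box-δ-singletons : ∀ N k w ws (g : Word → Carrier) → length ws ≡ k → concat ws ≡ w → All (_≤ N) w →
    ∑ (box N k) (λ js → δ _≟TB_ (singletons js) ws * g js) ≈ δ _≟TB_ (singletons w) ws * g w
  ∑-box-δ-singletons N k w ws g lw cw w≤N = cases (ws ≟TB singletons w)
    where
    cases : Dec (ws ≡ singletons w) → ∑ (box N k) (λ js → δ _≟TB_ (singletons js) ws * g js) ≈ δ _≟TB_ (singletons w) ws * g w
    cases (yes ≡.refl) = begin
      ∑ (box N k) (λ js → δ _≟TB_ (singletons js) (singletons w) * g js)
        ≈⟨ ∑-cong (box N k) (λ js → *-cong (δ-singletons js w) refl) ⟩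
      ∑ (box N k) (λ js → δ _≟W_ w js * g js)
        ≈⟨ ∑-box-δ N k w g (≡.trans (≡.sym (LP.length-map _ w)) lw) w≤N ⟩
      g w
        ≈⟨ trans (*-cong (δ-refl _≟TB_ (singletons w)) refl) (*-identityˡ _) ⟨
      δ _≟TB_ (singletons w) (singletons w) * g w
        ∎
    cases (no ws≢w) = trans
      (∑-zero (box N k) (λ js → trans (*-cong (δ-≢ _≟TB_ {singletons js} {ws}
        (λ e → ws≢w (≡.trans e (≡.cong singletons (≡.trans (≡.sym (concat-singletons js)) (≡.trans (≡.cong concat (≡.sym e)) cw)))))) refl) (zeroˡ _)))
      (sym (trans (*-cong (δ-≢ _≟TB_ ws≢w) refl) (zeroˡ _)))

  δW-counitˡ : ∀ w → Nonempty w → (g : TB → Carrier) → ⟪ δW w , (λ (q , qs) → εW q * g qs) ⟫ ≈ g (w ∷ [])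
  δW-counitˡ w nw g = begin
    ⟪ δW w , G ⟫
      ≈⟨ ⟪formulaW⟫-expand M w G ⟩
    ∑< M (λ k → ∑ (decIter k w) (λ ws → ∑ (box M (suc k)) (λ js → ⟪ bar (D'⊗ js ws) , (λ t → G (js , t)) ⟫)))
      ≈⟨ ∑<-cong M (λ k → ∑-cong (decIter k w) (λ ws → ∑-cong (box M (suc k)) (λ js →
        trans (⟪⟫-*ˡ (bar (D'⊗ js ws)) (εW js) {g}) (*-cong (εW≈δ js) refl)))) ⟩
    ∑< M (λ k → ∑ (decIter k w) (λ ws → ∑ (box M (suc k)) (λ js → δ _≟W_ (0 ∷ []) js * term ws js)))
      ≈⟨ ∑<-single M 0 (ℕP.≤-trans nw (ℕP.m≤m+n _ _)) only-one-factor ⟩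
    ∑ (box M 1) (λ js → δ _≟W_ (0 ∷ []) js * term (w ∷ []) js) + 0#
      ≈⟨ +-identityʳ _ ⟩
    ∑ (box M 1) (λ js → δ _≟W_ (0 ∷ []) js * term (w ∷ []) js)
      ≈⟨ ∑-box-δ M 1 (0 ∷ []) (term (w ∷ [])) ≡.refl (z≤n ∷ []) ⟩
    ⟪ lmul2 _∷_ ((1# , w) ∷ []) ((1# , []) ∷ []) , g ⟫
      ≈⟨ ⟪⟫-lmul2 _∷_ ((1# , w) ∷ []) ((1# , []) ∷ []) {g} ⟩
    ⟪ (1# , w) ∷ [] , (λ x → ⟪ (1# , []) ∷ [] , (λ y → g (x ∷ y)) ⟫) ⟫
      ≈⟨ trans (⟪⟫-single w {λ x → ⟪ (1# , []) ∷ [] , (λ y → g (x ∷ y)) ⟫}) (⟪⟫-single [] {λ y → g (w ∷ y)}) ⟩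
    g (w ∷ [])
      ∎
    where
    M = length w ℕ.+ weight w
    G : Word × TB → Carrier
    G (q , qs) = εW q * g qs
    term : List Word → List ℕ → Carrier
    term ws js = ⟪ bar (D'⊗ js ws) , g ⟫
    only-one-factor : ∀ k → k ≢ 0 → ∑ (decIter k w) (λ ws → ∑ (box M (suc k)) (λ js → δ _≟W_ (0 ∷ []) js * term ws js)) ≈ 0#
    only-one-factor zero    0≢0 = ⊥-elim (0≢0 ≡.refl)
    only-one-factor (suc k) _   = ∑-zero (decIter (suc k) w) (λ ws → ∑-box-δ-outside M (suc (suc k)) (0 ∷ []) (term ws) (λ { (() , _) }))

  δW-counitʳ : ∀ w → Nonempty w → (g : Word → Carrier) → ⟪ δW w , (λ (q , qs) → ε1 qs * g q) ⟫ ≈ g w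
  δW-counitʳ w nw g = begin
    ⟪ δW w , G ⟫
      ≈⟨ ⟪formulaW⟫-expand M w G ⟩
    ∑< M (λ k → ∑ (decIter k w) (λ ws → ∑ (box M (suc k)) (λ js → ⟪ bar (D'⊗ js ws) , (λ t → G (js , t)) ⟫)))
      ≈⟨ ∑<-cong M (λ k → ∑-congᴬ (decIter-splits k w nw) (λ {ws} (lw , _ , cw) →
        trans (∑-congᴬ (box-bounded M (suc k)) (λ {js} (lj , _) → counit-term js ws (≡.trans lj (≡.sym lw))))
        (∑-box-δ-singletons M (suc k) w ws g lw cw w≤M))) ⟩
    ∑< M (λ k → ∑ (decIter k w) (λ ws → δ _≟TB_ (singletons w) ws * g w))
      ≈⟨ ∑<-cong M (λ k → ∑-*ʳ (decIter k w) (g w)) ⟩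
    ∑< M (λ k → ∑ (decIter k w) (δ _≟TB_ (singletons w)) * g w)
      ≈⟨ ∑<-single M (ℕ.pred (length w)) pred-length<M (λ k k≢ →
        trans (*-cong (∑-decIter-singletons-other k w nw (λ e → k≢ (≡.cong ℕ.pred e))) refl) (zeroˡ _)) ⟩
    ∑ (decIter (ℕ.pred (length w)) w) (δ _≟TB_ (singletons w)) * g w
      ≈⟨ *-cong (∑-decIter-singletons w nw) refl ⟩
    1# * g w
      ≈⟨ *-identityˡ _ ⟩
    g w
      ∎
    where
    M = length w ℕ.+ weight w
    G : Word × TB → Carrier
    G (q , qs) = ε1 qs * g q
    w≤M : All (_≤ M) w
    w≤M = All.map (λ a≤ → ℕP.≤-trans a≤ (ℕP.m≤n+m (weight w) (length w))) (letter≤weight w)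
    pred<+ : ∀ n → 1 ≤ n → ℕ.pred n < n ℕ.+ weight w
    pred<+ (suc n) _ = ℕP.m≤m+n (suc n) (weight w)
    pred-length<M : ℕ.pred (length w) < M
    pred-length<M = pred<+ (length w) nw
    counit-term : ∀ js ws → length js ≡ length ws → ⟪ bar (D'⊗ js ws) , (λ t → ε1 t * g js) ⟫ ≈ δ _≟TB_ (singletons js) ws * g js
    counit-term js ws l = trans (⟪⟫-*ʳ (bar (D'⊗ js ws)) (g js) {ε1}) (*-cong (ε-bar-D'⊗ js ws l) refl)

  ε1-++ : ∀ a b → ε1 (a ++ b) ≈ ε1 a * ε1 b
  ε1-++ []      b = sym (*-identityˡ _)
  ε1-++ (w ∷ a) b = trans (*-congˡ (ε1-++ a b)) (sym (*-assoc _ _ _))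

  δT1-counitˡ : ∀ t → All Nonempty t → (h : TB → Carrier) → ⟪ δT1 t , (λ (a , b) → ε1 a * h b) ⟫ ≈ h t
  δT1-counitˡ []      _         h = trans (⟪⟫-single ([] , []) {λ (a , b) → ε1 a * h b}) (*-identityˡ _)
  δT1-counitˡ (w ∷ t) (nw ∷ nt) h = begin
    ⟪ δT1 (w ∷ t) , (λ (a , b) → ε1 a * h b) ⟫
      ≈⟨ ⟪⟫-lmul2 _ (δW w) (δT1 t) ⟩
    ⟪ δW w , (λ (q , qs) → ⟪ δT1 t , (λ (a , b) → (εW q * ε1 a) * h (qs ++ b)) ⟫) ⟫
      ≈⟨ ⟪⟫-cong (δW w) (λ (q , qs) → trans (⟪⟫-cong (δT1 t) (λ _ → *-assoc _ _ _)) (⟪⟫-*ˡ (δT1 t) (εW q))) ⟩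
    ⟪ δW w , (λ (q , qs) → εW q * ⟪ δT1 t , (λ (a , b) → ε1 a * h (qs ++ b)) ⟫) ⟫
      ≈⟨ ⟪⟫-cong (δW w) (λ (q , qs) → *-congˡ (δT1-counitˡ t nt (λ b → h (qs ++ b)))) ⟩
    ⟪ δW w , (λ (q , qs) → εW q * h (qs ++ t)) ⟫
      ≈⟨ δW-counitˡ w nw (λ qs → h (qs ++ t)) ⟩
    h (w ∷ t) ∎

  δT1-counitʳ : ∀ t → All Nonempty t → (h : TB → Carrier) → ⟪ δT1 t , (λ (a , b) → ε1 b * h a) ⟫ ≈ h t
  δT1-counitʳ []      _         h = trans (⟪⟫-single ([] , []) {λ (a , b) → ε1 b * h a}) (*-identityˡ _)
  δT1-counitʳ (w ∷ t) (nw ∷ nt) h = begin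
    ⟪ δT1 (w ∷ t) , (λ (a , b) → ε1 b * h a) ⟫
      ≈⟨ ⟪⟫-lmul2 _ (δW w) (δT1 t) ⟩
    ⟪ δW w , (λ (q , qs) → ⟪ δT1 t , (λ (a , b) → ε1 (qs ++ b) * h (q ∷ a)) ⟫) ⟫
      ≈⟨ ⟪⟫-cong (δW w) (λ (q , qs) → trans (⟪⟫-cong (δT1 t) (λ (a , b) → trans (*-cong (ε1-++ qs b) refl) (*-assoc _ _ _)))
                                            (⟪⟫-*ˡ (δT1 t) (ε1 qs))) ⟩
    ⟪ δW w , (λ (q , qs) → ε1 qs * ⟪ δT1 t , (λ (a , b) → ε1 b * h (q ∷ a)) ⟫) ⟫
      ≈⟨ ⟪⟫-cong (δW w) (λ (q , qs) → *-congˡ (δT1-counitʳ t nt (λ a → h (q ∷ a)))) ⟩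
    ⟪ δW w , (λ (q , qs) → ε1 qs * h (q ∷ t)) ⟫
      ≈⟨ δW-counitʳ w nw (λ q → h (q ∷ t)) ⟩
    h (w ∷ t) ∎

  coeff-contract-δT : ∀ (F : TB × TB → Carrier) (π : TB × TB → TB) t y →
    coeffWith _≟TB_ (lbind (λ p → (F p , π p) ∷ []) (δT t)) y ≈ ⟪ t , (λ x → ⟪ δT1 x , (λ p → F p * δ _≟TB_ y (π p)) ⟫) ⟫
  coeff-contract-δT F π t y = begin
    coeffWith _≟TB_ (lbind contract (δT t)) y
      ≈⟨ coeff≈⟪δ⟫ _≟TB_ (lbind contract (δT t)) y ⟩
    ⟪ lbind contract (δT t) , δ _≟TB_ y ⟫
      ≈⟨ ⟪⟫-lbind contract (δT t) ⟩
    ⟪ δT t , (λ p → ⟪ contract p , δ _≟TB_ y ⟫) ⟫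
      ≈⟨ ⟪⟫-lbind δT1 t ⟩
    ⟪ t , (λ x → ⟪ δT1 x , (λ p → ⟪ contract p , δ _≟TB_ y ⟫) ⟫) ⟫
      ≈⟨ ⟪⟫-cong t (λ x → ⟪⟫-cong (δT1 x) (λ p → +-identityʳ _)) ⟩
    ⟪ t , (λ x → ⟪ δT1 x , (λ p → F p * δ _≟TB_ y (π p)) ⟫) ⟫
      ∎
    where
    contract : TB × TB → Lin TB
    contract p = (F p , π p) ∷ []

  δT-counit : ∀ t → PlusT t → EqWith _≟TB_ (ε⊗Id (δT t)) t × EqWith _≟TB_ (Id⊗ε (δT t)) t
  δT-counit t plus =
    (λ y → trans (coeff-contract-δT (ε1 ∘ proj₁) proj₂ t y)
                 (trans (⟪⟫-congᴬ plus (λ {x} nx → δT1-counitˡ x nx (δ _≟TB_ y))) (sym (coeff≈⟪δ⟫ _≟TB_ t y)))) ,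
    (λ y → trans (coeff-contract-δT (ε1 ∘ proj₂) proj₁ t y)
                 (trans (⟪⟫-congᴬ plus (λ {x} nx → δT1-counitʳ x nx (δ _≟TB_ y))) (sym (coeff≈⟪δ⟫ _≟TB_ t y))))

  ε≈⟪ε1⟫ : ∀ u → ε u ≡ ⟪ u , ε1 ⟫
  ε≈⟪ε1⟫ []            = ≡.refl
  ε≈⟪ε1⟫ ((a , t) ∷ u) = ≡.cong (a * ε1 t +_) (ε≈⟪ε1⟫ u)

  constant-term-prefixed : ∀ x (ws : List Word) → ⟪ ones (map (x ∷_) ws) , δ _≟W_ [] ⟫ ≈ 0#
  constant-term-prefixed x ws =
    trans (⟪⟫-ones (map (x ∷_) ws) _) (trans (reflexive (∑-map (x ∷_) ws)) (∑-zero ws (λ v → δ-≢ _≟W_ {[]} {x ∷ v} (λ ()))))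

  constant-term-dX0 : ∀ w → ⟪ ones (dX0 w) , δ _≟W_ [] ⟫ ≈ δ _≟W_ (0 ∷ []) w
  constant-term-dX0 []              = sym (δ-≢ _≟W_ {0 ∷ []} {[]} (λ ()))
  constant-term-dX0 (zero ∷ [])     =
    trans (+-cong (trans (*-identityˡ _) (δ-refl _≟W_ [])) (constant-term-prefixed 0 []))
          (trans (+-identityʳ _) (sym (δ-refl _≟W_ (0 ∷ []))))
  constant-term-dX0 (zero ∷ y ∷ w)  =
    trans (+-cong (trans (*-identityˡ _) (δ-≢ _≟W_ {[]} {y ∷ w} (λ ()))) (constant-term-prefixed 0 (dX0 (y ∷ w))))
          (trans (+-identityʳ _) (sym (δ-≢ _≟W_ {0 ∷ []} {0 ∷ y ∷ w} (λ ()))))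
  constant-term-dX0 (suc i ∷ w)     = trans (constant-term-prefixed (suc i) (dX0 w)) (sym (δ-≢ _≟W_ {0 ∷ []} {suc i ∷ w} (λ ())))

  ε-inT : ∀ P → ε (inT P) ≈ dX0at0 P
  ε-inT P = begin
    ε (inT P)
      ≡⟨ ≡.trans (ε≈⟪ε1⟫ (inT P)) (∑-map _ P) ⟩
    ⟪ P , (λ w → εW w * 1#) ⟫
      ≈⟨ ⟪⟫-cong P (λ w → trans (*-identityʳ _) (trans (εW≈δ w) (sym (constant-term-dX0 w)))) ⟩
    ⟪ P , (λ w → ⟪ ones (dX0 w) , δ _≟W_ [] ⟫) ⟫
      ≈⟨ ⟪⟫-lbind (λ w → ones (dX0 w)) P ⟨
    ⟪ lbind (λ w → ones (dX0 w)) P , δ _≟W_ [] ⟫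
      ≈⟨ coeff≈⟪δ⟫ _≟W_ (lbind (λ w → ones (dX0 w)) P) [] ⟨
    dX0at0 P
      ∎

  -- Duality with the operadic composition

  count : List Word → Word → Carrier
  count vs a = ∑ vs (δ _≟W_ a)

  count-prefixed : ∀ x y vs r → count (map (x ∷_) vs) (y ∷ r) ≈ δ ℕ._≟_ y x * count vs r
  count-prefixed x y vs r = begin
    count (map (x ∷_) vs) (y ∷ r)
      ≡⟨ ∑-map (x ∷_) vs ⟩
    ∑ vs (λ v → δ _≟W_ (y ∷ r) (x ∷ v))
      ≈⟨ ∑-cong vs (λ v → δ-∷ ℕ._≟_ _≟W_ y x r v) ⟩
    ∑ vs (λ v → δ ℕ._≟_ y x * δ _≟W_ r v)
      ≈⟨ ∑-*ˡ vs (δ ℕ._≟_ y x) ⟩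
    δ ℕ._≟_ y x * count vs r
      ∎

  count-other-length : ∀ vs a n → All (λ v → length v ≡ n) vs → length a ≢ n → count vs a ≈ 0#
  count-other-length vs a n lengths a≢ = ∑-zeroᴬ lengths (λ {v} l → δ-≢ _≟W_ {a} {v} (λ { ≡.refl → a≢ l }))

  D'1-D1-adjoint : ∀ u y → count (D'1 u) y ≈ count (D1 y) u
  D'1-D1-adjoint []          []      = refl
  D'1-D1-adjoint []          (b ∷ y) = sym (count-other-length (D1 (b ∷ y)) [] _ (D1-length (b ∷ y)) (λ ()))
  D'1-D1-adjoint (a ∷ u)     []      = count-other-length (D'1 (a ∷ u)) [] _ (All.map proj₁ (D'1-length-weight (a ∷ u))) (λ ())
  D'1-D1-adjoint (zero ∷ u)  (b ∷ y) = begin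
    count (D'1 (zero ∷ u)) (b ∷ y)
      ≈⟨ count-prefixed 0 b (D'1 u) y ⟩
    δ ℕ._≟_ b 0 * count (D'1 u) y
      ≈⟨ *-cong (δ-sym ℕ._≟_ ℕ._≟_ b 0) (D'1-D1-adjoint u y) ⟩
    δ ℕ._≟_ 0 b * count (D1 y) u
      ≈⟨ +-identityˡ _ ⟨
    0# + δ ℕ._≟_ 0 b * count (D1 y) u
      ≈⟨ +-cong (trans (δ-∷ ℕ._≟_ _≟W_ 0 (suc b) u y) (trans (*-cong (δ-≢ ℕ._≟_ {0} {suc b} (λ ())) refl) (zeroˡ _)))
                (count-prefixed b 0 (D1 y) u) ⟨
    count (D1 (b ∷ y)) (zero ∷ u)
      ∎
  D'1-D1-adjoint (suc a ∷ u) (b ∷ y) = begin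
    count (D'1 (suc a ∷ u)) (b ∷ y)
      ≈⟨ +-cong (δ-∷ ℕ._≟_ _≟W_ b a y u) (count-prefixed (suc a) b (D'1 u) y) ⟩
    δ ℕ._≟_ b a * δ _≟W_ y u + δ ℕ._≟_ b (suc a) * count (D'1 u) y
      ≈⟨ +-cong (*-cong (trans (δ-sym ℕ._≟_ ℕ._≟_ b a) (sym (δ-suc a b))) (δ-sym _≟W_ _≟W_ y u))
                (*-cong (δ-sym ℕ._≟_ ℕ._≟_ b (suc a)) (D'1-D1-adjoint u y)) ⟩
    δ ℕ._≟_ (suc a) (suc b) * δ _≟W_ u y + δ ℕ._≟_ (suc a) b * count (D1 y) u
      ≈⟨ +-cong (δ-∷ ℕ._≟_ _≟W_ (suc a) (suc b) u y) (count-prefixed b (suc a) (D1 y) u) ⟨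
    count (D1 (b ∷ y)) (suc a ∷ u)
      ∎

  D'-adjoint-D : ∀ (X Y : Lin Word) → ⟪ D' X , (λ v → ⟪ Y , δ _≟W_ v ⟫) ⟫ ≈ ⟪ X , (λ u → ⟪ D Y , δ _≟W_ u ⟫) ⟫
  D'-adjoint-D X Y = begin
    ⟪ D' X , (λ v → ⟪ Y , δ _≟W_ v ⟫) ⟫
      ≈⟨ ⟪⟫-lbind (λ w → ones (D'1 w)) X ⟩
    ⟪ X , (λ u → ⟪ ones (D'1 u) , (λ v → ⟪ Y , δ _≟W_ v ⟫) ⟫) ⟫
      ≈⟨ ⟪⟫-cong X (λ u → trans (⟪⟫-ones (D'1 u) _) (∑-⟪⟫-swap (D'1 u) Y (δ _≟W_))) ⟩
    ⟪ X , (λ u → ⟪ Y , (λ y → ∑ (D'1 u) (λ v → δ _≟W_ v y)) ⟫) ⟫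
      ≈⟨ ⟪⟫-cong X (λ u → ⟪⟫-cong Y (λ y →
        trans (∑-cong (D'1 u) (λ v → δ-sym _≟W_ _≟W_ v y)) (D'1-D1-adjoint u y))) ⟩
    ⟪ X , (λ u → ⟪ Y , (λ y → ∑ (D1 y) (δ _≟W_ u)) ⟫) ⟫
      ≈⟨ ⟪⟫-cong X (λ u → trans (⟪⟫-cong Y (λ y → sym (⟪⟫-ones (D1 y) (δ _≟W_ u))))
        (sym (⟪⟫-lbind (λ w → ones (D1 w)) Y))) ⟩
    ⟪ X , (λ u → ⟪ D Y , δ _≟W_ u ⟫) ⟫
      ∎

  iter-comm : ∀ {a} {A : Set a} j (f : A → A) x → iter j f (f x) ≡ f (iter j f x)
  iter-comm zero    f x = ≡.refl
  iter-comm (suc j) f x = ≡.cong f (iter-comm j f x)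

  D'-iter-adjoint : ∀ j (X Y : Lin Word) → ⟪ iter j D' X , (λ v → ⟪ Y , δ _≟W_ v ⟫) ⟫ ≈ ⟪ X , (λ u → ⟪ iter j D Y , δ _≟W_ u ⟫) ⟫
  D'-iter-adjoint zero    X Y = refl
  D'-iter-adjoint (suc j) X Y = trans (D'-adjoint-D (iter j D' X) Y) (trans (D'-iter-adjoint j X (D Y))
    (⟪⟫-cong X (λ u → reflexive (≡.cong (λ Z → ⟪ Z , δ _≟W_ u ⟫) (iter-comm j D Y)))))

  factor-pairings : List ℕ → List (Lin Word) → List Word → Carrier
  factor-pairings (j ∷ js) (Q ∷ Qs) (u ∷ ws) = ⟪ iter j D Q , δ _≟W_ u ⟫ * factor-pairings js Qs ws
  factor-pairings []       []       []       = 1#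
  factor-pairings _        _        _        = 0#

  ⟪bar⟫-δ-∷ : ∀ Q Qs v t → ⟪ bar (Q ∷ Qs) , δ _≟TB_ (v ∷ t) ⟫ ≈ ⟪ Q , δ _≟W_ v ⟫ * ⟪ bar Qs , δ _≟TB_ t ⟫
  ⟪bar⟫-δ-∷ Q Qs v t = begin
    ⟪ bar (Q ∷ Qs) , δ _≟TB_ (v ∷ t) ⟫
      ≈⟨ ⟪⟫-lmul2 _∷_ Q (bar Qs) ⟩
    ⟪ Q , (λ v′ → ⟪ bar Qs , (λ t′ → δ _≟TB_ (v ∷ t) (v′ ∷ t′)) ⟫) ⟫
      ≈⟨ ⟪⟫-cong Q (λ v′ → trans (⟪⟫-cong (bar Qs) (λ t′ → δ-∷ _≟W_ _≟TB_ v v′ t t′))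
        (⟪⟫-*ˡ (bar Qs) (δ _≟W_ v v′))) ⟩
    ⟪ Q , (λ v′ → δ _≟W_ v v′ * ⟪ bar Qs , δ _≟TB_ t ⟫) ⟫
      ≈⟨ ⟪⟫-*ʳ Q _ ⟩
    ⟪ Q , δ _≟W_ v ⟫ * ⟪ bar Qs , δ _≟TB_ t ⟫
      ∎

  bar-D'⊗-pairing : ∀ js ws Qs → length js ≡ length ws → length ws ≡ length Qs →
    ⟪ bar (D'⊗ js ws) , (λ t → ⟪ bar Qs , δ _≟TB_ t ⟫) ⟫ ≈ factor-pairings js Qs ws
  bar-D'⊗-pairing []       []       []       _  _  =
    trans (⟪⟫-single [] {λ t → ⟪ bar [] , δ _≟TB_ t ⟫}) (trans (⟪⟫-single [] {δ _≟TB_ []}) (δ-refl _≟TB_ []))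
  bar-D'⊗-pairing (j ∷ js) (u ∷ ws) (Q ∷ Qs) l₁ l₂ = begin
    ⟪ bar (D'⊗ (j ∷ js) (u ∷ ws)) , (λ t → ⟪ bar (Q ∷ Qs) , δ _≟TB_ t ⟫) ⟫
      ≈⟨ ⟪⟫-lmul2 _∷_ (D'-iter j u) (bar (D'⊗ js ws)) ⟩
    ⟪ D'-iter j u , (λ v → ⟪ bar (D'⊗ js ws) , (λ t → ⟪ bar (Q ∷ Qs) , δ _≟TB_ (v ∷ t) ⟫) ⟫) ⟫
      ≈⟨ ⟪⟫-cong (D'-iter j u) (λ v → trans (⟪⟫-cong (bar (D'⊗ js ws)) (λ t → ⟪bar⟫-δ-∷ Q Qs v t)) (⟪⟫-*ˡ (bar (D'⊗ js ws)) _)) ⟩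
    ⟪ D'-iter j u , (λ v → ⟪ Q , δ _≟W_ v ⟫ * rest) ⟫
      ≈⟨ ⟪⟫-*ʳ (D'-iter j u) rest ⟩
    ⟪ D'-iter j u , (λ v → ⟪ Q , δ _≟W_ v ⟫) ⟫ * rest
      ≈⟨ *-cong (trans (D'-iter-adjoint j ((1# , u) ∷ []) Q) (⟪⟫-single u {λ u′ → ⟪ iter j D Q , δ _≟W_ u′ ⟫}))
                (bar-D'⊗-pairing js ws Qs (ℕP.suc-injective l₁) (ℕP.suc-injective l₂)) ⟩
    ⟪ iter j D Q , δ _≟W_ u ⟫ * factor-pairings js Qs ws
      ∎
    where
    rest = ⟪ bar (D'⊗ js ws) , (λ t → ⟪ bar Qs , δ _≟TB_ t ⟫) ⟫

  redDec-δ : ∀ w a b → Nonempty a → Nonempty b → ∑ (redDec w) (λ (u , v) → δ _≟W_ u a * δ _≟W_ v b) ≈ δ _≟W_ w (a ++ b)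
  redDec-δ []          (a₀ ∷ a′)      b          _ _  = sym (δ-≢ _≟W_ {[]} {a₀ ∷ a′ ++ b} (λ ()))
  redDec-δ (x ∷ [])    (a₀ ∷ a′)      (b₀ ∷ b′)  _ _  =
    sym (δ-≢ _≟W_ {x ∷ []} {a₀ ∷ a′ ++ b₀ ∷ b′} (λ e → ++-∷-nonempty a′ (LP.∷-injectiveʳ e)))
    where
    ++-∷-nonempty : ∀ (a′ : Word) → a′ ++ b₀ ∷ b′ ≢ []
    ++-∷-nonempty []      ()
    ++-∷-nonempty (_ ∷ _) ()
  redDec-δ (x ∷ y ∷ w) (a₀ ∷ [])      b          _ nb = begin
    δ _≟W_ (x ∷ []) (a₀ ∷ []) * δ _≟W_ (y ∷ w) b + ∑ (map m (redDec (y ∷ w))) f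
      ≈⟨ +-cong (*-cong (trans (δ-∷ ℕ._≟_ _≟W_ x a₀ [] []) (trans (*-congˡ (δ-refl _≟W_ [])) (*-identityʳ _))) refl)
                (trans (reflexive (∑-map m (redDec (y ∷ w))))
                       (∑-zeroᴬ (redDec-splits (y ∷ w)) (λ { {u , v} (nu , _) →
                         trans (*-cong (trans (δ-∷ ℕ._≟_ _≟W_ x a₀ u []) (trans (*-congˡ (δ-≢ _≟W_ {u} {[]} (λ { ≡.refl → nonempty-[] nu })))
                                                                                 (zeroʳ _))) refl) (zeroˡ _) }))) ⟩
    δ ℕ._≟_ x a₀ * δ _≟W_ (y ∷ w) b + 0#
      ≈⟨ trans (+-identityʳ _) (sym (δ-∷ ℕ._≟_ _≟W_ x a₀ (y ∷ w) b)) ⟩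
    δ _≟W_ (x ∷ y ∷ w) (a₀ ∷ b)
      ∎
    where
    f : Word × Word → Carrier
    f (u , v) = δ _≟W_ u (a₀ ∷ []) * δ _≟W_ v b
    m : Word × Word → Word × Word
    m (u , v) = (x ∷ u) , v
    nonempty-[] : ¬ Nonempty []
    nonempty-[] ()
  redDec-δ (x ∷ y ∷ w) (a₀ ∷ a₁ ∷ a′) b          _ nb = begin
    δ _≟W_ (x ∷ []) (a₀ ∷ a₁ ∷ a′) * δ _≟W_ (y ∷ w) b + ∑ (map m (redDec (y ∷ w))) f
      ≈⟨ +-cong (trans (*-cong (δ-≢ _≟W_ {x ∷ []} {a₀ ∷ a₁ ∷ a′} (λ ())) refl) (zeroˡ _))
                (trans (reflexive (∑-map m (redDec (y ∷ w))))
                       (∑-cong (redDec (y ∷ w)) (λ (u , v) → trans (*-cong (δ-∷ ℕ._≟_ _≟W_ x a₀ u (a₁ ∷ a′)) refl) (*-assoc _ _ _)))) ⟩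
    0# + ∑ (redDec (y ∷ w)) (λ (u , v) → δ ℕ._≟_ x a₀ * (δ _≟W_ u (a₁ ∷ a′) * δ _≟W_ v b))
      ≈⟨ trans (+-identityˡ _) (∑-*ˡ (redDec (y ∷ w)) (δ ℕ._≟_ x a₀)) ⟩
    δ ℕ._≟_ x a₀ * ∑ (redDec (y ∷ w)) (λ (u , v) → δ _≟W_ u (a₁ ∷ a′) * δ _≟W_ v b)
      ≈⟨ *-congˡ (redDec-δ (y ∷ w) (a₁ ∷ a′) b (s≤s z≤n) nb) ⟩
    δ ℕ._≟_ x a₀ * δ _≟W_ (y ∷ w) (a₁ ∷ a′ ++ b)
      ≈⟨ δ-∷ ℕ._≟_ _≟W_ x a₀ (y ∷ w) (a₁ ∷ a′ ++ b) ⟨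
    δ _≟W_ (x ∷ y ∷ w) (a₀ ∷ a₁ ∷ a′ ++ b)
      ∎
    where
    f : Word × Word → Carrier
    f (u , v) = δ _≟W_ u (a₀ ∷ a₁ ∷ a′) * δ _≟W_ v b
    m : Word × Word → Word × Word
    m (u , v) = (x ∷ u) , v

  ⟪++⟫-redDec : ∀ (A C : Lin Word) w → Supp Nonempty A → Supp Nonempty C →
    ⟪ lmul2 _++_ A C , δ _≟W_ w ⟫ ≈ ∑ (redDec w) (λ (u , v) → ⟪ A , δ _≟W_ u ⟫ * ⟪ C , δ _≟W_ v ⟫)
  ⟪++⟫-redDec A C w nA nC = begin
    ⟪ lmul2 _++_ A C , δ _≟W_ w ⟫
      ≈⟨ ⟪⟫-lmul2 _++_ A C ⟩
    ⟪ A , (λ a → ⟪ C , (λ b → δ _≟W_ w (a ++ b)) ⟫) ⟫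
      ≈⟨ ⟪⟫-congᴬ nA (λ {a} na → ⟪⟫-congᴬ nC (λ {b} nb → sym (redDec-δ w a b na nb))) ⟩
    ⟪ A , (λ a → ⟪ C , (λ b → ∑ (redDec w) (λ (u , v) → δ _≟W_ u a * δ _≟W_ v b)) ⟫) ⟫
      ≈⟨ ⟪⟫-cong A (λ a → sym (∑-⟪⟫-swap (redDec w) C (λ (u , v) b → δ _≟W_ u a * δ _≟W_ v b))) ⟩
    ⟪ A , (λ a → ∑ (redDec w) (λ (u , v) → ⟪ C , (λ b → δ _≟W_ u a * δ _≟W_ v b) ⟫)) ⟫
      ≈⟨ ∑-⟪⟫-swap (redDec w) A (λ (u , v) a → ⟪ C , (λ b → δ _≟W_ u a * δ _≟W_ v b) ⟫) ⟨
    ∑ (redDec w) (λ (u , v) → ⟪ A , (λ a → ⟪ C , (λ b → δ _≟W_ u a * δ _≟W_ v b) ⟫) ⟫)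
      ≈⟨ ∑-cong (redDec w) (λ (u , v) → trans (⟪⟫-cong A (λ a → ⟪⟫-*ˡ C (δ _≟W_ u a))) (⟪⟫-*ʳ A _)) ⟩
    ∑ (redDec w) (λ (u , v) → ⟪ A , δ _≟W_ u ⟫ * ⟪ C , δ _≟W_ v ⟫)
      ∎

  D-iter-supp : ∀ j {X} → Supp Nonempty X → Supp Nonempty (iter j D X)
  D-iter-supp zero    nX = nX
  D-iter-supp (suc j) nX = supp-lbind (λ {x} nx → supp-ones (All.map (λ e → ≡.subst (1 ≤_) (≡.sym e) nx) (D1-length x))) (D-iter-supp j nX)

  compW-supp : ∀ j q Q Qs → Plus Q → Supp Nonempty (compW (j ∷ q) (Q ∷ Qs))
  compW-supp j q Q Qs nQ = supp-lmul2 {Q = λ _ → ⊤}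
    (λ {a} {b} na _ → ℕP.≤-trans na (ℕP.≤-trans (ℕP.m≤m+n (length a) (length b)) (ℕP.≤-reflexive (≡.sym (LP.length-++ a)))))
    (D-iter-supp j nQ) (All.universal (λ _ → tt) (compW q Qs))

  decIter-compW : ∀ k q Qs w → length q ≡ suc k → length Qs ≡ suc k → All Plus Qs →
    ∑ (decIter k w) (factor-pairings q Qs) ≈ ⟪ compW q Qs , δ _≟W_ w ⟫
  decIter-compW zero    (j ∷ [])     (Q ∷ [])      w _ _ _ = begin
    ⟪ iter j D Q , δ _≟W_ w ⟫ * 1# + 0#
      ≈⟨ trans (+-identityʳ _) (*-identityʳ _) ⟩
    ⟪ iter j D Q , δ _≟W_ w ⟫
      ≈⟨ ⟪⟫-cong (iter j D Q) (λ a → trans (⟪⟫-single [] {λ b → δ _≟W_ w (a ++ b)})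
        (reflexive (≡.cong (δ _≟W_ w) (LP.++-identityʳ a)))) ⟨
    ⟪ iter j D Q , (λ a → ⟪ (1# , []) ∷ [] , (λ b → δ _≟W_ w (a ++ b)) ⟫) ⟫
      ≈⟨ ⟪⟫-lmul2 _++_ (iter j D Q) ((1# , []) ∷ []) ⟨
    ⟪ compW (j ∷ []) (Q ∷ []) , δ _≟W_ w ⟫
      ∎
  decIter-compW (suc k) (j ∷ j′ ∷ q) (Q ∷ Q′ ∷ Qs) w l₁ l₂ (nQ ∷ nQs@(nQ′ ∷ _)) = begin
    ∑ (decIter (suc k) w) (factor-pairings (j ∷ j′ ∷ q) (Q ∷ Q′ ∷ Qs))
      ≈⟨ ∑-concatMap (λ (u , v) → map (u ∷_) (decIter k v)) (redDec w) ⟩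
    ∑ (redDec w) (λ (u , v) → ∑ (map (u ∷_) (decIter k v)) (factor-pairings (j ∷ j′ ∷ q) (Q ∷ Q′ ∷ Qs)))
      ≈⟨ ∑-cong (redDec w) (λ (u , v) → trans (reflexive (∑-map (u ∷_) (decIter k v))) (∑-*ˡ (decIter k v) _)) ⟩
    ∑ (redDec w) (λ (u , v) → ⟪ iter j D Q , δ _≟W_ u ⟫ * ∑ (decIter k v) (factor-pairings (j′ ∷ q) (Q′ ∷ Qs)))
      ≈⟨ ∑-cong (redDec w) (λ (u , v) →
           *-congˡ (decIter-compW k (j′ ∷ q) (Q′ ∷ Qs) v (ℕP.suc-injective l₁) (ℕP.suc-injective l₂) nQs)) ⟩
    ∑ (redDec w) (λ (u , v) → ⟪ iter j D Q , δ _≟W_ u ⟫ * ⟪ compW (j′ ∷ q) (Q′ ∷ Qs) , δ _≟W_ v ⟫)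
      ≈⟨ ⟪++⟫-redDec (iter j D Q) (compW (j′ ∷ q) (Q′ ∷ Qs)) w (D-iter-supp j nQ) (compW-supp j′ q Q′ Qs nQ′) ⟨
    ⟪ compW (j ∷ j′ ∷ q) (Q ∷ Q′ ∷ Qs) , δ _≟W_ w ⟫
      ∎

  formulaW-dual-compW : ∀ N w q Qs k → Nonempty w → length w ≤ N → weight w ≤ N →
    length q ≡ suc k → length Qs ≡ suc k → All Plus Qs →
    ⟪ formulaW N w , (λ (p , t) → δ _≟W_ q p * ⟪ bar Qs , δ _≟TB_ t ⟫) ⟫ ≈ ⟪ compW q Qs , δ _≟W_ w ⟫
  formulaW-dual-compW N w q Qs k nw lw≤N ww≤N lq lQs nQs = begin
    ⟪ formulaW N w , G ⟫
      ≈⟨ ⟪formulaW⟫-expand N w G ⟩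
    ∑< N (λ k′ → ∑ (decIter k′ w) (λ ws → ∑ (box N (suc k′)) (λ js → ⟪ bar (D'⊗ js ws) , (λ t → G (js , t)) ⟫)))
      ≈⟨ ∑<-cong N (λ k′ → trans (∑-cong (decIter k′ w) (λ ws → ∑-cong (box N (suc k′)) (λ js → ⟪⟫-*ˡ (bar (D'⊗ js ws)) (δ _≟W_ q js))))
                        (trans (∑-swap (decIter k′ w) (box N (suc k′)) (λ ws js → δ _≟W_ q js * pairing js ws))
                               (∑-cong (box N (suc k′)) (λ js → ∑-*ˡ (decIter k′ w) (δ _≟W_ q js))))) ⟩
    ∑< N (λ k′ → ∑ (box N (suc k′)) (λ js → δ _≟W_ q js * ∑ (decIter k′ w) (pairing js)))
      ≈⟨ only-q-contributes ⟩
    ∑ (decIter k w) (pairing q)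
      ≈⟨ ∑-congᴬ (decIter-splits k w nw) (λ {ws} (lw , _ , _) →
           bar-D'⊗-pairing q ws Qs (≡.trans lq (≡.sym lw)) (≡.trans lw (≡.sym lQs))) ⟩
    ∑ (decIter k w) (factor-pairings q Qs)
      ≈⟨ decIter-compW k q Qs w lq lQs nQs ⟩
    ⟪ compW q Qs , δ _≟W_ w ⟫
      ∎
    where
    G : Word × TB → Carrier
    G (p , t) = δ _≟W_ q p * ⟪ bar Qs , δ _≟TB_ t ⟫
    pairing : List ℕ → List Word → Carrier
    pairing js ws = ⟪ bar (D'⊗ js ws) , (λ t → ⟪ bar Qs , δ _≟TB_ t ⟫) ⟫
    F : ℕ → Carrier
    F k′ = ∑ (box N (suc k′)) (λ js → δ _≟W_ q js * ∑ (decIter k′ w) (pairing js))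
    other-k : ∀ k′ → k′ ≢ k → F k′ ≈ 0#
    other-k k′ k′≢k = ∑-box-δ-outside N (suc k′) q _ (λ (l , _) → k′≢k (ℕP.suc-injective (≡.trans (≡.sym l) lq)))
    -- a splitting of w into k + 1 nonempty factors forces k < length w ≤ N
    too-many-factors : ¬ k < N → ∑ (decIter k w) (pairing q) ≈ 0#
    too-many-factors k≮N = ∑-zeroᴬ (decIter-splits k w nw) (λ {ws} (l , nws , cw) → ⊥-elim (k≮N
      (ℕP.≤-trans (ℕP.≤-reflexive (≡.sym l)) (ℕP.≤-trans (length≤length-concat ws nws) (ℕP.≤-trans (ℕP.≤-reflexive (≡.cong length cw)) lw≤N)))))
    -- D' lowers the weight, so each index of q is at most weight w ≤ N on the support of the pairing
    index-too-large : ¬ All (_≤ N) q → ∑ (decIter k w) (pairing q) ≈ 0#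
    index-too-large q≰N = ∑-zeroᴬ (decIter-splits k w nw) (λ {ws} (l , nws , cw) →
      ⟪⟫-zeroᴬ (bar-D'⊗-supp q ws (≡.trans lq (≡.sym l)) nws) (λ {t} (_ , _ , et , _) → ⊥-elim (q≰N (All.map (λ {a} a≤ →
        ℕP.≤-trans a≤ (ℕP.≤-trans (ℕP.m≤n+m (sum q) (weightTB t))
          (ℕP.≤-trans (ℕP.≤-reflexive (≡.trans et (≡.trans (weightTB-concat ws) (≡.cong weight cw)))) ww≤N))) (letter≤weight q)))))
    only-q-contributes : ∑< N F ≈ ∑ (decIter k w) (pairing q)
    only-q-contributes with k ℕ.<? N | All.all? (ℕ._≤? N) q
    ... | yes k<N | yes q≤N = trans (∑<-single N k k<N other-k) (∑-box-δ N (suc k) q _ lq q≤N)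
    ... | no  k≮N | _       = trans (∑<-single-outside N k k≮N other-k) (sym (too-many-factors k≮N))
    ... | yes _   | no  q≰N =
      trans (∑<-zero N (λ k′ → ∑-box-δ-outside N (suc k′) q _ (λ (_ , q≤N) → q≰N q≤N))) (sym (index-too-large q≰N))

  formula-dual-comp : ∀ N P → Plus P → Bounds N P → ∀ k Q Qs → 1 ≤ k →
    All (λ (_ , q) → length q ≡ k) Q → length Qs ≡ k → All Plus Qs →
    pairWith _≟WT_ (formula N P) (tens Q Qs) ≈ pairWith _≟W_ P (comp Q Qs)
  formula-dual-comp N P nP bP (suc k) Q Qs _ lQ lQs nQs = begin
    pairWith _≟WT_ (formula N P) (tens Q Qs)
      ≈⟨ pair≈⟪⟫ _≟WT_ (formula N P) (tens Q Qs) ⟩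
    ⟪ tens Q Qs , (λ b → ⟪ formula N P , δ _≟WT_ b ⟫) ⟫
      ≈⟨ ⟪⟫-lmul2 _,_ Q (bar Qs) ⟩
    ⟪ Q , (λ q → ⟪ bar Qs , (λ t → ⟪ lbind (formulaW N) P , δ _≟WT_ (q , t) ⟫) ⟫) ⟫
      ≈⟨ ⟪⟫-cong Q (λ q → trans (⟪⟫-cong (bar Qs) (λ t → ⟪⟫-lbind (formulaW N) P)) (⟪⟫-swap (bar Qs) P _)) ⟩
    ⟪ Q , (λ q → ⟪ P , (λ w → ⟪ bar Qs , (λ t → ⟪ formulaW N w , δ _≟WT_ (q , t) ⟫) ⟫) ⟫) ⟫
      ≈⟨ ⟪⟫-cong Q (λ q → ⟪⟫-cong P (λ w → trans (⟪⟫-swap (bar Qs) (formulaW N w) _)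
                                                 (⟪⟫-cong (formulaW N w) (λ (p , s) → separate q p s)))) ⟩
    ⟪ Q , (λ q → ⟪ P , (λ w → ⟪ formulaW N w , (λ (p , s) → δ _≟W_ q p * ⟪ bar Qs , δ _≟TB_ s ⟫) ⟫) ⟫) ⟫
      ≈⟨ ⟪⟫-congᴬ lQ (λ {q} lq → ⟪⟫-congᴬ (All.zip (nP , bP)) (λ {w} (nw , lw≤N , ww≤N) →
           formulaW-dual-compW N w q Qs k nw lw≤N ww≤N lq lQs nQs)) ⟩
    ⟪ Q , (λ q → ⟪ P , (λ w → ⟪ compW q Qs , δ _≟W_ w ⟫) ⟫) ⟫
      ≈⟨ ⟪⟫-cong Q (λ q → trans (⟪⟫-swap (compW q Qs) P (δ _≟W_))
                                (⟪⟫-cong P (λ w → ⟪⟫-cong (compW q Qs) (λ b → δ-sym _≟W_ _≟W_ b w)))) ⟨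
    ⟪ Q , (λ q → ⟪ compW q Qs , (λ b → ⟪ P , δ _≟W_ b ⟫) ⟫) ⟫
      ≈⟨ ⟪⟫-lbind (λ q → compW q Qs) Q ⟨
    ⟪ comp Q Qs , (λ b → ⟪ P , δ _≟W_ b ⟫) ⟫
      ≈⟨ pair≈⟪⟫ _≟W_ P (comp Q Qs) ⟨
    pairWith _≟W_ P (comp Q Qs)
      ∎
    where
    separate : ∀ q p s → ⟪ bar Qs , (λ t → δ _≟WT_ (q , t) (p , s)) ⟫ ≈ δ _≟W_ q p * ⟪ bar Qs , δ _≟TB_ s ⟫
    separate q p s = trans (⟪⟫-cong (bar Qs) (λ t → δ-, _≟W_ _≟TB_ _≟WT_ q p t s))
                           (trans (⟪⟫-*ˡ (bar Qs) (δ _≟W_ q p)) (*-congˡ (⟪⟫-cong (bar Qs) (λ t → δ-sym _≟TB_ _≟TB_ t s))))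


open Linear

proposition3p7 : ∀ {c ℓ : Level} (K : CharZeroField c ℓ) →
    let open Over K in
    (∀ (N : ℕ) (P : Lin Word) → Plus P → Bounds N P →
      (∀ (k : ℕ) (Q : Lin Word) (Qs : List (Lin Word)) → 1 ≤ k →
         All (λ { (_ , q) → length q ≡ k }) Q → length Qs ≡ k → All Plus Qs →
         pairWith _≟WT_ (formula N P) (tens Q Qs) ≈ pairWith _≟W_ P (comp Q Qs))
      × (∀ (q : Word) (qs : TB) →
           ¬ (Nonempty q × All Nonempty qs × length q ≡ length qs) →
           coeffWith _≟WT_ (formula N P) (q , qs) ≈ 0#))
    × (∀ (t : Lin TB) → PlusT t →
         EqWith _≟TB_ (ε⊗Id (δT t)) t × EqWith _≟TB_ (Id⊗ε (δT t)) t)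
    × (∀ (P : Lin Word) → Plus P → ε (inT P) ≈ dX0at0 P)
    × (∀ (n : ℕ) (t : Lin TB) → PlusT t → All (λ { (_ , b) → weightTB b ≡ n }) t →
         ∀ (b : TB × TB) → weightTT b ≢ n → coeffWith _≟TT_ (δT t) b ≈ 0#)
    × (∀ (d : ℤ) (t : Lin TB) → PlusT t → All (λ { (_ , b) → degreeTB b ≡ d }) t →
         ∀ (b : TB × TB) → degreeTT b ≢ d → coeffWith _≟TT_ (δT t) b ≈ 0#)
proposition3p7 K =
  (λ N P nP bP → formula-dual-comp K N P nP bP , formula-supp K N P nP) ,
  δT-counit K ,
  (λ P _ → ε-inT K P) ,
  δT-homogeneous K weightTB weightTT proj₁ ,
  δT-homogeneous K degreeTB degreeTT (λ {t} {ab} → degreeTB-cosplit {t} {ab})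
  where open Over K using (weightTT; degreeTT)
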